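{- Let $n$ be a positive integer and define $\chi_3:\mathbb{Z}_n^{\ast}\to\{1,-1\}$ by $\chi_3(a)=1$ if $x^2\equiv a\pmod n$ has a solution and $\chi_3(a)=-1$ otherwise. If $\mathbb{Z}_n^{\ast}$ is not cyclic, then $\chi_3$ is not a character, i.e. it is not multiplicative on $\mathbb{Z}_n^{\ast}$.
   Context: $\mathbb{Z}_n^{\ast}$ is the group of units of $\mathbb{Z}_n$. -}

module Defs where

open import Data.Nat using (ℕ; _*_; _^_; _<_; NonZero)
open import Data.Nat.DivMod using (_%_)
open import Data.Nat.Coprimality using (Coprime)
open import Data.Nat.Properties using (_≟_)
open import Data.Fin using (Fin; toℕ)
open import Data.Fin.Properties using (any?)
open import Data.Integer using (ℤ; +_; -_)
open import Data.Product using (Σ; ∃; _×_)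
open import Relation.Binary.PropositionalEquality using (_≡_)
open import Relation.Nullary using (yes; no)

-- Elements of ℤ_n^* are represented by residues a with 0 ≤ a < n and gcd(a,n)=1.
IsUnit : (n : ℕ) → ℕ → Set
IsUnit n a = (a < n) × Coprime a n

Cyclic : (n : ℕ) → .{{NonZero n}} → Set
Cyclic n = Σ ℕ λ g → IsUnit n g × (∀ a → IsUnit n a → ∃ λ k → (g ^ k) % n ≡ a)

-- x² ≡ a (mod n) has a solution (x ranges over residues mod n, which suffices).
IsSquareMod : (n : ℕ) → .{{NonZero n}} → ℕ → Set
IsSquareMod n a = ∃ λ (x : Fin n) → (toℕ x * toℕ x) % n ≡ a % n

χ₃ : (n : ℕ) → .{{NonZero n}} → ℕ → ℤ
χ₃ n a with any? {n} (λ (x : Fin n) → ((toℕ x * toℕ x) % n) ≟ (a % n))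
... | yes _ = + 1
... | no _  = - (+ 1)

IsMultiplicativeχ₃ : (n : ℕ) → .{{NonZero n}} → Set
IsMultiplicativeχ₃ n = ∀ a b → IsUnit n a → IsUnit n b →
  χ₃ n ((a * b) % n) ≡ χ₃ n a Data.Integer.* χ₃ n b

-- A unit group (ℤ/n)^* that is not cyclic forces n to be a power of 2 divisible by 8, or divisible by 4 and an
-- odd prime, or divisible by two distinct odd primes: for n = 1, 2, 4, p^{α+1}, 2p^{α+1} a generator exists.
-- Modulo p it is a primitive root g, found as an element whose order m annihilates every unit (then x^m - 1
-- has p - 1 roots, so m = p - 1); modulo p^{α+1} it is G = g^{p^α} (1 + p), because every unit ≡ 1 (mod p) is
-- a power of G^{p-1} ≡ (1 + p)^{p-1}. In the three remaining cases the Chinese remainder theorem yields units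
-- a, b such that a, b and ab are non-squares modulo divisors of n (3, 5 and 15 modulo 8; otherwise a primitive
-- root modulo p combined with 3 modulo 4, or with a primitive root modulo q), so χ₃(ab) = -1 ≠ 1 = χ₃(a) χ₃(b).

module Submission where

open import Defs
open import Data.Nat as ℕ using (ℕ; zero; suc; NonZero; NonTrivial; _≤_; _<_; z≤n; s≤s; z<s)
import Data.Nat.Properties as ℕ
import Data.Nat.DivMod as ℕ
open import Data.Nat.Divisibility as ℕ using (_∣_; divides)
open import Data.Nat.Coprimality as Cop using (Coprime; coprime-divisor)
open import Data.Nat.GCD using (module Bézout)
open import Data.Nat.Primality using (Prime; prime[2]; euclidsLemma; prime⇒irreducible; prime⇒nonZero; prime⇒nonTrivial)
open import Data.Nat.Primality.Factorisation using (factorise)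
open import Data.Nat.ListAction using (product)
import Data.Nat.Tactic.RingSolver as ℕ
open import Data.Nat.Induction using (<-wellFounded)
open import Induction.WellFounded using (Acc; acc)
open import Data.List using ([]; _∷_)
open import Data.Nat.Combinatorics using (_C_; nCk+nC[k+1]≡[n+1]C[k+1]; nC1≡n)
open import Data.Fin as Fin using (Fin; toℕ; fromℕ<)
open import Data.Vec using (Vec; []; _∷_; replicate)
import Data.Fin.Properties as FinP
open import Data.List.Relation.Unary.All using ([]; _∷_)
open import Data.Integer as ℤ using (ℤ; 0ℤ; 1ℤ; +_; _+_; _*_; _-_; -_; _^_; _%ℕ_; _/ℕ_)
import Data.Integer.Properties as ℤ
import Data.Integer.DivMod as ℤ
open import Data.Integer.Divisibility.Signed as ℤ using (divides) renaming (_∣_ to _∣ℤ_)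
open import Data.Integer.Tactic.RingSolver using (solve-∀)
open import Data.Product using (∃; ∃₂; _×_; _,_; proj₁; proj₂)
open import Data.Sum using (_⊎_; inj₁; inj₂; [_,_]′)
open import Data.Empty using (⊥; ⊥-elim)
open import Level using (0ℓ)
open import Relation.Nullary using (¬_; Dec; yes; no)
import Relation.Nullary.Decidable as Dec
open import Relation.Nullary.Decidable using (True; toWitness; toWitnessFalse; ¬?)
open import Relation.Binary.Bundles using (Setoid)
open import Relation.Binary.Structures using (IsEquivalence)
import Relation.Binary.Reasoning.Setoid as SetoidReasoning
open import Function using (_∘_; id; case_of_)
open import Relation.Binary.PropositionalEquality

-- Elementary number theory

prime>1 : ∀ {p} → Prime p → 1 < p
prime>1 {p} prime-p = ℕ.nonTrivial⇒n>1 p {{prime⇒nonTrivial prime-p}}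

prime∤⇒coprime : ∀ {p a} → Prime p → ¬ p ∣ a → Coprime p a
prime∤⇒coprime prime-p p∤a (i∣p , i∣a) with prime⇒irreducible prime-p i∣p
... | inj₁ i≡1  = i≡1
... | inj₂ refl = ⊥-elim (p∤a i∣a)

coprime-* : ∀ {a b c} → Coprime a b → Coprime a c → Coprime a (b ℕ.* c)
coprime-* {a} {b} cop-ab cop-ac {i} (i∣a , i∣bc) =
  cop-ac (i∣a , coprime-divisor (λ (j∣i , j∣b) → cop-ab (ℕ.∣-trans j∣i i∣a , j∣b)) i∣bc)

coprime-^ : ∀ {a b} → Coprime a b → ∀ e → Coprime a (b ℕ.^ e)
coprime-^ _   zero    (_ , i∣1) = ℕ.∣1⇒≡1 i∣1
coprime-^ cop (suc e) = coprime-* cop (coprime-^ cop e)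

coprime⇒*∣ : ∀ {a b k} → Coprime a b → a ∣ k → b ∣ k → a ℕ.* b ∣ k
coprime⇒*∣ {a} {b} cop (divides u refl) b∣ua
  with coprime-divisor (Cop.sym cop) (subst (b ∣_) (ℕ.*-comm u a) b∣ua)
... | divides v refl = divides v (trans (ℕ.*-assoc v b a) (cong (v ℕ.*_) (ℕ.*-comm b a)))

prime∣^⇒∣ : ∀ {p a} → Prime p → ∀ e → p ∣ a ℕ.^ e → p ∣ a
prime∣^⇒∣ prime-p zero    p∣1 = ⊥-elim (ℕ.<⇒≢ (prime>1 prime-p) (sym (ℕ.∣1⇒≡1 p∣1)))
prime∣^⇒∣ {a = a} prime-p (suc e) p∣a^e+1 with euclidsLemma a (a ℕ.^ e) prime-p p∣a^e+1
... | inj₁ p∣a   = p∣a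
... | inj₂ p∣a^e = prime∣^⇒∣ prime-p e p∣a^e

prime∤⇒coprime-^ : ∀ {p a} → Prime p → ¬ p ∣ a → ∀ e → Coprime a (p ℕ.^ e)
prime∤⇒coprime-^ prime-p p∤a = coprime-^ (Cop.sym (prime∤⇒coprime prime-p p∤a))

coprime⇒∤ : ∀ {p a n} → Prime p → Coprime a n → p ∣ n → ¬ p ∣ a
coprime⇒∤ prime-p a⊥n p∣n p∣a = ℕ.<⇒≢ (prime>1 prime-p) (sym (a⊥n (p∣a , p∣n)))

^-∣-^ : ∀ q {a b} → a ≤ b → q ℕ.^ a ∣ q ℕ.^ b
^-∣-^ q {a} {b} a≤b = divides (q ℕ.^ (b ℕ.∸ a)) (begin
  q ℕ.^ b                         ≡⟨ cong (q ℕ.^_) (ℕ.m+[n∸m]≡n a≤b) ⟨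
  q ℕ.^ (a ℕ.+ (b ℕ.∸ a))         ≡⟨ ℕ.^-distribˡ-+-* q a (b ℕ.∸ a) ⟩
  q ℕ.^ a ℕ.* q ℕ.^ (b ℕ.∸ a)     ≡⟨ ℕ.*-comm (q ℕ.^ a) _ ⟩
  q ℕ.^ (b ℕ.∸ a) ℕ.* q ℕ.^ a     ∎)
  where open ≡-Reasoning

prime-divisor : ∀ n → .{{NonTrivial n}} → ∃ λ p → Prime p × p ∣ n
prime-divisor n@(suc (suc _)) with factorise n
... | record { factors = p ∷ ps ; isFactorisation = n≡p*ps ; factorsPrime = prime-p ∷ _ } =
  p , prime-p , divides (product ps) (trans n≡p*ps (ℕ.*-comm p _))

module _ {q} (prime-q : Prime q) where

  private instance
    q≢0 : NonZero q
    q≢0 = prime⇒nonZero prime-q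

  prime-power-split : ∀ n → .{{NonZero n}} → ∃₂ λ f m → n ≡ q ℕ.^ f ℕ.* m × ¬ q ∣ m
  prime-power-split n = split n (<-wellFounded n)
    where
    split : ∀ n → .{{NonZero n}} → Acc _<_ n → ∃₂ λ f m → n ≡ q ℕ.^ f ℕ.* m × ¬ q ∣ m
    split n (acc rec) with q ℕ.∣? n
    ... | no q∤n = 0 , n , sym (ℕ.+-identityʳ n) , q∤n
    ... | yes (divides k refl) =
      let instance k≢0 = ℕ.m*n≢0⇒m≢0 k
          f , m , k≡q^f*m , q∤m = split k (rec (ℕ.m<m*n k q (prime>1 prime-q)))
      in suc f , m , trans (cong (ℕ._* q) k≡q^f*m) (reorder (q ℕ.^ f) m q) , q∤m
      where
      reorder : ∀ a b q → a ℕ.* b ℕ.* q ≡ q ℕ.* a ℕ.* b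
      reorder = ℕ.solve-∀

∤⇒prime-power-∤ : ∀ s r → .{{NonZero s}} → ¬ s ∣ r → ∃₂ λ q e → Prime q × q ℕ.^ e ∣ s × ¬ q ℕ.^ e ∣ r
∤⇒prime-power-∤ s r = go s (<-wellFounded s)
  where
  go : ∀ s → .{{NonZero s}} → Acc _<_ s → ¬ s ∣ r → ∃₂ λ q e → Prime q × q ℕ.^ e ∣ s × ¬ q ℕ.^ e ∣ r
  go 1 _ 1∤r = ⊥-elim (1∤r (ℕ.1∣ r))
  go s@(suc (suc _)) (acc rec) s∤r with prime-divisor s
  ... | q , prime-q , q∣s with prime-power-split prime-q s
  ... | a , s₁ , s≡q^a*s₁ , q∤s₁ with q ℕ.^ a ℕ.∣? r
  ... | no q^a∤r = q , a , prime-q , divides s₁ (trans s≡q^a*s₁ (ℕ.*-comm (q ℕ.^ a) s₁)) , q^a∤r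
  ... | yes q^a∣r =
    let q′ , e , prime-q′ , q′^e∣s₁ , q′^e∤r = go s₁ (rec s₁<s) s₁∤r
    in q′ , e , prime-q′ , ℕ.∣-trans q′^e∣s₁ (divides (q ℕ.^ a) s≡q^a*s₁) , q′^e∤r
    where
    instance
      s₁≢0 : NonZero s₁
      s₁≢0 = ℕ.m*n≢0⇒n≢0 (q ℕ.^ a) {{subst NonZero s≡q^a*s₁ ℕ.nonZero}}
    s₁∤r : ¬ s₁ ∣ r
    s₁∤r s₁∣r = s∤r (subst (_∣ r) (sym s≡q^a*s₁)
      (coprime⇒*∣ (Cop.sym (prime∤⇒coprime-^ prime-q q∤s₁ a)) q^a∣r s₁∣r))
    a≢0 : a ≢ 0
    a≢0 refl = q∤s₁ (subst (q ∣_) (trans s≡q^a*s₁ (ℕ.+-identityʳ s₁)) q∣s)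
    s₁<s : s₁ < s
    s₁<s = subst (s₁ <_) (trans (ℕ.*-comm s₁ (q ℕ.^ a)) (sym s≡q^a*s₁))
      (ℕ.m<m*n s₁ (q ℕ.^ a) (ℕ.^-monoʳ-< q (prime>1 prime-q) (ℕ.n≢0⇒n>0 a≢0)))

∣∧<⇒≡0 : ∀ {n m} → n ∣ m → m < n → m ≡ 0
∣∧<⇒≡0 (divides zero    refl) _   = refl
∣∧<⇒≡0 (divides (suc q) refl) m<n = ⊥-elim (ℕ.m+n≮m _ _ m<n)

pred-< : ∀ {r n} → r ≢ 0 → r < n → ℕ.pred r < ℕ.pred n
pred-< {zero}  r≢0 _   = ⊥-elim (r≢0 refl)
pred-< {suc r} _   r<n = ℕ.suc[m]≤n⇒m≤pred[n] r<n

pred-injective : ∀ {r s} → r ≢ 0 → s ≢ 0 → ℕ.pred r ≡ ℕ.pred s → r ≡ s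
pred-injective {zero}          r≢0 _   _  = ⊥-elim (r≢0 refl)
pred-injective {suc _} {zero}  _   s≢0 _  = ⊥-elim (s≢0 refl)
pred-injective {suc _} {suc _} _   _   eq = cong suc eq

2∣n⊎2∣1+n : ∀ n → 2 ∣ n ⊎ 2 ∣ suc n
2∣n⊎2∣1+n zero    = inj₁ (2 ℕ.∣0)
2∣n⊎2∣1+n (suc n) with 2∣n⊎2∣1+n n
... | inj₁ 2∣n   = inj₂ (ℕ.∣m∣n⇒∣m+n ℕ.∣-refl 2∣n)
... | inj₂ 2∣1+n = inj₁ 2∣1+n

2∤1 : ¬ 2 ∣ 1
2∤1 2∣1 = case ℕ.∣1⇒≡1 2∣1 of λ ()

odd⇒1+2h : ∀ {n} → ¬ 2 ∣ n → ∃ λ h → n ≡ suc (h ℕ.+ h)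
odd⇒1+2h {zero}  2∤n = ⊥-elim (2∤n (2 ℕ.∣0))
odd⇒1+2h {suc n} 2∤n with 2∣n⊎2∣1+n n
... | inj₁ (divides h n≡h*2) = h , cong suc (trans n≡h*2 (double h))
  where
  double : ∀ h → h ℕ.* 2 ≡ h ℕ.+ h
  double = ℕ.solve-∀
... | inj₂ 2∣1+n = ⊥-elim (2∤n 2∣1+n)

C₂-suc : ∀ t → suc t C 2 ≡ t C 2 ℕ.+ t
C₂-suc t = begin
  suc t C 2            ≡⟨ nCk+nC[k+1]≡[n+1]C[k+1] t 1 ⟨
  t C 1 ℕ.+ t C 2      ≡⟨ cong (ℕ._+ t C 2) (nC1≡n t) ⟩
  t ℕ.+ t C 2          ≡⟨ ℕ.+-comm t _ ⟩
  t C 2 ℕ.+ t          ∎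
  where open ≡-Reasoning

C₂-odd : ∀ h → suc (h ℕ.+ h) C 2 ≡ h ℕ.* suc (h ℕ.+ h)
C₂-odd zero    = refl
C₂-odd (suc h) = begin
  suc (suc h ℕ.+ suc h) C 2            ≡⟨ cong (λ t → suc (suc t) C 2) (ℕ.+-suc h h) ⟩
  suc (suc t) C 2                      ≡⟨ C₂-suc (suc t) ⟩
  suc t C 2 ℕ.+ suc t                  ≡⟨ cong (ℕ._+ suc t) (C₂-suc t) ⟩
  t C 2 ℕ.+ t ℕ.+ suc t                ≡⟨ cong (λ c → c ℕ.+ t ℕ.+ suc t) (C₂-odd h) ⟩
  h ℕ.* t ℕ.+ t ℕ.+ suc t              ≡⟨ step h ⟩
  suc h ℕ.* suc (suc h ℕ.+ suc h)      ∎
  where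
  open ≡-Reasoning
  t = suc (h ℕ.+ h)
  step : ∀ h → h ℕ.* suc (h ℕ.+ h) ℕ.+ suc (h ℕ.+ h) ℕ.+ suc (suc (h ℕ.+ h)) ≡ suc h ℕ.* suc (suc h ℕ.+ suc h)
  step = ℕ.solve-∀

power≡1+multiple-of-pred : ∀ q k → ∃ λ K → suc q ℕ.^ k ≡ suc (q ℕ.* K)
power≡1+multiple-of-pred q zero    = 0 , cong suc (sym (ℕ.*-zeroʳ q))
power≡1+multiple-of-pred q (suc k) with power≡1+multiple-of-pred q k
... | K , [1+q]^k≡1+qK = suc (q ℕ.* K) ℕ.+ K , trans (cong (suc q ℕ.*_) [1+q]^k≡1+qK) (expand q K)
  where
  expand : ∀ q K → suc q ℕ.* suc (q ℕ.* K) ≡ suc (q ℕ.* (suc (q ℕ.* K) ℕ.+ K))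
  expand = ℕ.solve-∀

least-or-none : ∀ {P : ℕ → Set} → (∀ n → Dec (P n)) → ∀ n →
                (∀ k → k < n → ¬ P k) ⊎ ∃ λ m → P m × (∀ k → k < m → ¬ P k)
least-or-none P? zero = inj₁ λ _ ()
least-or-none P? (suc n) with least-or-none P? n
... | inj₂ least = inj₂ least
... | inj₁ none-below-n with P? n
...   | yes Pn = inj₂ (n , Pn , none-below-n)
...   | no ¬Pn = inj₁ λ k k<1+n → [ none-below-n k , (λ { refl → ¬Pn }) ]′ (ℕ.m<1+n⇒m<n∨m≡n k<1+n)

least-witness : ∀ {P : ℕ → Set} → (∀ n → Dec (P n)) → ∀ {n} → P n → ∃ λ m → P m × (∀ k → k < m → ¬ P k)
least-witness P? {n} Pn with least-or-none P? (suc n)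
... | inj₁ none  = ⊥-elim (none n ℕ.≤-refl Pn)
... | inj₂ least = least

-- Congruences of integers

infix 4 _≡_mod_
record _≡_mod_ (a b d : ℤ) : Set where
  constructor mod-by
  field modulus∣difference : d ∣ℤ a - b
open _≡_mod_ public

module _ {d : ℤ} where

  mod-reflexive : ∀ {a b} → a ≡ b → a ≡ b mod d
  mod-reflexive {a} refl = mod-by (divides 0ℤ (trans (ℤ.+-inverseʳ a) (sym (ℤ.*-zeroˡ d))))

  mod-refl : ∀ {a} → a ≡ a mod d
  mod-refl = mod-reflexive refl

  mod-sym : ∀ {a b} → a ≡ b mod d → b ≡ a mod d
  mod-sym {a} {b} (mod-by d∣a-b) = mod-by (subst (d ∣ℤ_) (negate-difference a b) (ℤ.∣m⇒∣-m d∣a-b))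
    where
    negate-difference : ∀ a b → - (a - b) ≡ b - a
    negate-difference = solve-∀

  mod-trans : ∀ {a b c} → a ≡ b mod d → b ≡ c mod d → a ≡ c mod d
  mod-trans {a} {b} {c} (mod-by d∣a-b) (mod-by d∣b-c) =
    mod-by (subst (d ∣ℤ_) (telescope a b c) (ℤ.∣m∣n⇒∣m+n d∣a-b d∣b-c))
    where
    telescope : ∀ a b c → (a - b) + (b - c) ≡ a - c
    telescope = solve-∀

  +-cong-mod : ∀ {a b c e} → a ≡ b mod d → c ≡ e mod d → a + c ≡ b + e mod d
  +-cong-mod {a} {b} {c} {e} (mod-by d∣a-b) (mod-by d∣c-e) =
    mod-by (subst (d ∣ℤ_) (regroup a b c e) (ℤ.∣m∣n⇒∣m+n d∣a-b d∣c-e))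
    where
    regroup : ∀ a b c e → (a - b) + (c - e) ≡ (a + c) - (b + e)
    regroup = solve-∀

  *-cong-mod : ∀ {a b c e} → a ≡ b mod d → c ≡ e mod d → a * c ≡ b * e mod d
  *-cong-mod {a} {b} {c} {e} (mod-by d∣a-b) (mod-by d∣c-e) =
    mod-by (subst (d ∣ℤ_) (regroup a b c e) (ℤ.∣m∣n⇒∣m+n (ℤ.∣m⇒∣m*n c d∣a-b) (ℤ.∣n⇒∣m*n b d∣c-e)))
    where
    regroup : ∀ a b c e → (a - b) * c + b * (c - e) ≡ a * c - b * e
    regroup = solve-∀

  ^-cong-mod : ∀ {a b} n → a ≡ b mod d → a ^ n ≡ b ^ n mod d
  ^-cong-mod zero    _   = mod-refl
  ^-cong-mod (suc n) a≡b = *-cong-mod a≡b (^-cong-mod n a≡b)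

  -‿cong-mod : ∀ {a b} → a ≡ b mod d → - a ≡ - b mod d
  -‿cong-mod {a} {b} (mod-by d∣a-b) = mod-by (subst (d ∣ℤ_) (negate a b) (ℤ.∣m⇒∣-m d∣a-b))
    where
    negate : ∀ a b → - (a - b) ≡ - a - - b
    negate = solve-∀

  +-congˡ-mod : ∀ c {a b} → a ≡ b mod d → c + a ≡ c + b mod d
  +-congˡ-mod c = +-cong-mod (mod-refl {c})

  *-congˡ-mod : ∀ c {a b} → a ≡ b mod d → c * a ≡ c * b mod d
  *-congˡ-mod c = *-cong-mod (mod-refl {c})

  *-congʳ-mod : ∀ c {a b} → a ≡ b mod d → a * c ≡ b * c mod d
  *-congʳ-mod c a≡b = *-cong-mod a≡b (mod-refl {c})

  ∣⇒≡0-mod : ∀ {a} → d ∣ℤ a → a ≡ 0ℤ mod d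
  ∣⇒≡0-mod {a} = mod-by ∘ subst (d ∣ℤ_) (sym (ℤ.+-identityʳ a))

  ≡0-mod⇒∣ : ∀ {a} → a ≡ 0ℤ mod d → d ∣ℤ a
  ≡0-mod⇒∣ {a} (mod-by d∣a-0) = subst (d ∣ℤ_) (ℤ.+-identityʳ a) d∣a-0

  mod-isEquivalence : IsEquivalence (λ a b → a ≡ b mod d)
  mod-isEquivalence = record { refl = mod-refl ; sym = mod-sym ; trans = mod-trans }

mod-∣ : ∀ {d e a b} → e ∣ℤ d → a ≡ b mod d → a ≡ b mod e
mod-∣ e∣d (mod-by d∣a-b) = mod-by (ℤ.∣-trans e∣d d∣a-b)

*-scale-mod : ∀ {d a b} k → a ≡ b mod d → a * k ≡ b * k mod d * k
*-scale-mod {d} {a} {b} k (mod-by d∣a-b) = mod-by (subst (d * k ∣ℤ_) (distribute a b k) (ℤ.*-monoˡ-∣ k d∣a-b))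
  where
  distribute : ∀ a b k → (a - b) * k ≡ a * k - b * k
  distribute = solve-∀

mod-setoid : ℤ → Setoid 0ℓ 0ℓ
mod-setoid d = record { isEquivalence = mod-isEquivalence {d} }

module mod-Reasoning (d : ℤ) = SetoidReasoning (mod-setoid d)

%ℕ-mod : ∀ x n .{{_ : NonZero n}} → x ≡ + (x %ℕ n) mod + n
%ℕ-mod x n = mod-by (divides (x /ℕ n) (begin
  x - + (x %ℕ n)                          ≡⟨ cong (_- + (x %ℕ n)) (ℤ.a≡a%ℕn+[a/ℕn]*n x n) ⟩
  + (x %ℕ n) + x /ℕ n * + n - + (x %ℕ n)  ≡⟨ cancel (+ (x %ℕ n)) (x /ℕ n * + n) ⟩
  x /ℕ n * + n                            ∎))
  where
  open ≡-Reasoning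
  cancel : ∀ r m → r + m - r ≡ m
  cancel = solve-∀

residue-unique-≤ : ∀ {n r s} → r ≤ s → s < n → + r ≡ + s mod + n → r ≡ s
residue-unique-≤ {n} {r} {s} r≤s s<n (mod-by n∣r-s) =
  ℕ.≤-antisym r≤s (ℕ.m∸n≡0⇒m≤n (∣∧<⇒≡0 n∣s∸r (ℕ.≤-<-trans (ℕ.m∸n≤m s r) s<n)))
  where
  n∣s∸r : n ∣ s ℕ.∸ r
  n∣s∸r = subst (n ∣_) (trans (cong ℤ.∣_∣ (ℤ.m-n≡m⊖n r s)) (ℤ.∣⊖∣-≤ r≤s)) (ℤ.∣⇒∣ᵤ n∣r-s)

residue-unique : ∀ {n r s} → r < n → s < n → + r ≡ + s mod + n → r ≡ s
residue-unique {r = r} {s} r<n s<n r≡s with ℕ.≤-total r s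
... | inj₁ r≤s = residue-unique-≤ r≤s s<n r≡s
... | inj₂ s≤r = sym (residue-unique-≤ s≤r r<n (mod-sym r≡s))

module _ (n : ℕ) .{{_ : NonZero n}} where

  mod⇒%ℕ-≡ : ∀ x y → x ≡ y mod + n → x %ℕ n ≡ y %ℕ n
  mod⇒%ℕ-≡ x y x≡y = residue-unique (ℤ.n%ℕd<d x n) (ℤ.n%ℕd<d y n)
    (mod-trans (mod-sym (%ℕ-mod x n)) (mod-trans x≡y (%ℕ-mod y n)))

  %ℕ-≡⇒mod : ∀ x y → x %ℕ n ≡ y %ℕ n → x ≡ y mod + n
  %ℕ-≡⇒mod x y eq = mod-trans (%ℕ-mod x n) (mod-trans (mod-reflexive (cong +_ eq)) (mod-sym (%ℕ-mod y n)))

  mod? : ∀ x y → Dec (x ≡ y mod + n)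
  mod? x y = Dec.map′ (%ℕ-≡⇒mod x y) (mod⇒%ℕ-≡ x y) (x %ℕ n ℕ.≟ y %ℕ n)

pos-^ : ∀ a k → + (a ℕ.^ k) ≡ (+ a) ^ k
pos-^ a zero    = refl
pos-^ a (suc k) = trans (ℤ.pos-* a (a ℕ.^ k)) (cong (+ a *_) (pos-^ a k))

idempotent-mod : ∀ {A B} → Coprime A B → ∃ λ e → e ≡ 1ℤ mod + A × e ≡ 0ℤ mod + B
idempotent-mod {A} {B} A⊥B = from-bézout (Cop.coprime-Bézout A⊥B)
  where
  lift : ∀ {m n} → m ≡ n → + m ≡ + n
  lift = cong (λ m → + m)
  from-bézout : Bézout.Identity 1 A B → ∃ λ e → e ≡ 1ℤ mod + A × e ≡ 0ℤ mod + B
  from-bézout (Bézout.+- x y 1+yB≡xA) =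
    - (+ y * + B) ,
    mod-by (divides (- + x) (trans (negate-both (+ y * + B) (+ x * + A) 1+yB≡xAℤ) (ℤ.neg-distribˡ-* (+ x) (+ A)))) ,
    ∣⇒≡0-mod (ℤ.∣m⇒∣-m (ℤ.∣n⇒∣m*n (+ y) (ℤ.∣-refl {+ B})))
    where
    1+yB≡xAℤ : 1ℤ + + y * + B ≡ + x * + A
    1+yB≡xAℤ = trans (cong (λ e → 1ℤ + e) (sym (ℤ.pos-* y B))) (trans (lift 1+yB≡xA) (ℤ.pos-* x A))
    negate-both : ∀ u v → 1ℤ + u ≡ v → - u - 1ℤ ≡ - v
    negate-both u v refl = solve-negation u
      where
      solve-negation : ∀ u → - u - 1ℤ ≡ - (1ℤ + u)
      solve-negation = solve-∀
  from-bézout (Bézout.-+ x y 1+xA≡yB) =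
    + y * + B ,
    mod-by (divides (+ x) (subtract-one (+ x * + A) (+ y * + B) 1+xA≡yBℤ)) ,
    ∣⇒≡0-mod (ℤ.∣n⇒∣m*n (+ y) (ℤ.∣-refl {+ B}))
    where
    1+xA≡yBℤ : 1ℤ + + x * + A ≡ + y * + B
    1+xA≡yBℤ = trans (cong (λ e → 1ℤ + e) (sym (ℤ.pos-* x A))) (trans (lift 1+xA≡yB) (ℤ.pos-* y B))
    subtract-one : ∀ u v → 1ℤ + u ≡ v → v - 1ℤ ≡ u
    subtract-one u v refl = cancel u
      where
      cancel : ∀ u → 1ℤ + u - 1ℤ ≡ u
      cancel = solve-∀

chinese-remainder : ∀ {A B} → Coprime A B → ∀ u v → ∃ λ x → x ≡ u mod + A × x ≡ v mod + B
chinese-remainder {A} {B} A⊥B u v = u * e + v * (1ℤ - e) , x≡u , x≡v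
  where
  e = proj₁ (idempotent-mod A⊥B)
  e≡1 = proj₁ (proj₂ (idempotent-mod A⊥B))
  e≡0 = proj₂ (proj₂ (idempotent-mod A⊥B))
  x≡u : u * e + v * (1ℤ - e) ≡ u mod + A
  x≡u = begin
    u * e + v * (1ℤ - e)       ≈⟨ +-cong-mod (*-congˡ-mod u e≡1) (*-congˡ-mod v (+-congˡ-mod 1ℤ (-‿cong-mod e≡1))) ⟩
    u * 1ℤ + v * (1ℤ - 1ℤ)     ≡⟨ simplify u v ⟩
    u                          ∎
    where
    open mod-Reasoning (+ A)
    simplify : ∀ u v → u * 1ℤ + v * (1ℤ - 1ℤ) ≡ u
    simplify = solve-∀
  x≡v : u * e + v * (1ℤ - e) ≡ v mod + B
  x≡v = begin
    u * e + v * (1ℤ - e)       ≈⟨ +-cong-mod (*-congˡ-mod u e≡0) (*-congˡ-mod v (+-congˡ-mod 1ℤ (-‿cong-mod e≡0))) ⟩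
    u * 0ℤ + v * (1ℤ - 0ℤ)     ≡⟨ simplify u v ⟩
    v                          ∎
    where
    open mod-Reasoning (+ B)
    simplify : ∀ u v → u * 0ℤ + v * (1ℤ - 0ℤ) ≡ v
    simplify = solve-∀

combine-mod : ∀ {A B x y} → Coprime A B → x ≡ y mod + A → x ≡ y mod + B → x ≡ y mod + (A ℕ.* B)
combine-mod A⊥B (mod-by A∣x-y) (mod-by B∣x-y) = mod-by (ℤ.∣ᵤ⇒∣ (coprime⇒*∣ A⊥B (ℤ.∣⇒∣ᵤ A∣x-y) (ℤ.∣⇒∣ᵤ B∣x-y)))

≡1-mod⇒coprime : ∀ {a B} → + a ≡ 1ℤ mod + B → Coprime a B
≡1-mod⇒coprime {a} {B} (mod-by B∣a-1) {i} (i∣a , i∣B) = ℕ.∣1⇒≡1 (ℤ.∣⇒∣ᵤ {+ i} {1ℤ}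
  (subst (+ i ∣ℤ_) (cancel (+ a)) (ℤ.∣m∣n⇒∣m-n (ℤ.∣ᵤ⇒∣ {+ i} {+ a} i∣a) (ℤ.∣-trans (ℤ.∣ᵤ⇒∣ {+ i} {+ B} i∣B) B∣a-1))))
  where
  cancel : ∀ a → a - (a - 1ℤ) ≡ 1ℤ
  cancel = solve-∀

odd⇒≡1-mod-2 : ∀ {x} → ¬ + 2 ∣ℤ x → x ≡ 1ℤ mod + 2
odd⇒≡1-mod-2 {x} 2∤x = mod-trans (%ℕ-mod x 2) (mod-reflexive (cong (λ r → + r) (residue≡1 (x %ℕ 2) refl (ℤ.n%ℕd<d x 2))))
  where
  residue≡1 : ∀ r → x %ℕ 2 ≡ r → r < 2 → r ≡ 1
  residue≡1 0             r≡0 _ = ⊥-elim (2∤x (≡0-mod⇒∣ (mod-trans (%ℕ-mod x 2) (mod-reflexive (cong (λ r → + r) r≡0)))))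
  residue≡1 1             _   _ = refl
  residue≡1 (suc (suc _)) _   (s≤s (s≤s ()))

-- Multiplicative orders

^-distribʳ-* : ∀ x y n → (x * y) ^ n ≡ x ^ n * y ^ n
^-distribʳ-* x y zero    = refl
^-distribʳ-* x y (suc n) = trans (cong ((x * y) *_) (^-distribʳ-* x y n)) (interchange x y (x ^ n) (y ^ n))
  where
  interchange : ∀ x y a b → x * y * (a * b) ≡ x * a * (y * b)
  interchange = solve-∀

module _ {d : ℤ} where

  ^≡1-mod-* : ∀ x m k → x ^ m ≡ 1ℤ mod d → x ^ (m ℕ.* k) ≡ 1ℤ mod d
  ^≡1-mod-* x m k x^m≡1 = subst₂ (_≡_mod d) (ℤ.^-*-assoc x m k) (ℤ.^-zeroˡ k) (^-cong-mod k x^m≡1)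

  ^≡1-mod-∣ : ∀ x m {n} → x ^ m ≡ 1ℤ mod d → m ∣ n → x ^ n ≡ 1ℤ mod d
  ^≡1-mod-∣ x m x^m≡1 (divides k refl) = subst (λ e → x ^ e ≡ 1ℤ mod d) (ℕ.*-comm m k) (^≡1-mod-* x m k x^m≡1)

  ≡1-mod-*-cancelˡ : ∀ {u v} → u ≡ 1ℤ mod d → u * v ≡ 1ℤ mod d → v ≡ 1ℤ mod d
  ≡1-mod-*-cancelˡ {u} {v} u≡1 uv≡1 = begin
    v       ≡⟨ ℤ.*-identityˡ v ⟨
    1ℤ * v  ≈⟨ *-congʳ-mod v (mod-sym u≡1) ⟩
    u * v   ≈⟨ uv≡1 ⟩
    1ℤ      ∎
    where open mod-Reasoning d

  ^-suc-multiple : ∀ x m K → x ^ m ≡ 1ℤ mod d → x ^ suc (m ℕ.* K) ≡ x mod d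
  ^-suc-multiple x m K x^m≡1 = begin
    x * x ^ (m ℕ.* K)    ≈⟨ *-congˡ-mod x (^≡1-mod-* x m K x^m≡1) ⟩
    x * 1ℤ               ≡⟨ ℤ.*-identityʳ x ⟩
    x                    ∎
    where open mod-Reasoning d

infix 4 _HasOrder_mod_
record _HasOrder_mod_ (x : ℤ) (m : ℕ) (d : ℤ) : Set where
  field
    order>0    : 0 < m
    ^order≡1   : x ^ m ≡ 1ℤ mod d
    order∣     : ∀ j → x ^ j ≡ 1ℤ mod d → m ∣ j
open _HasOrder_mod_ public

module _ {d : ℤ} where

  order-of-^ : ∀ {x} a b → x HasOrder (a ℕ.* b) mod d → (x ^ a) HasOrder b mod d
  order-of-^ {x} a b ord = record
    { order>0  = ℕ.n≢0⇒n>0 λ { refl → ℕ.<⇒≢ (order>0 ord) (sym (ℕ.*-zeroʳ a)) }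
    ; ^order≡1 = subst (_≡ 1ℤ mod d) (sym (ℤ.^-*-assoc x a b)) (^order≡1 ord)
    ; order∣   = λ j x^a^j≡1 → ℕ.*-cancelˡ-∣ a (order∣ ord (a ℕ.* j) (subst (_≡ 1ℤ mod d) (ℤ.^-*-assoc x a j) x^a^j≡1))
    }
    where
    instance
      a≢0 : NonZero a
      a≢0 = ℕ.m*n≢0⇒m≢0 a {{ℕ.>-nonZero (order>0 ord)}}

  order-of-* : ∀ {x y a b} → x HasOrder a mod d → y HasOrder b mod d → Coprime a b →
               (x * y) HasOrder (a ℕ.* b) mod d
  order-of-* {x} {y} {a} {b} ord-x ord-y a⊥b = record
    { order>0  = ℕ.*-mono-< (order>0 ord-x) (order>0 ord-y)
    ; ^order≡1 = begin
        (x * y) ^ (a ℕ.* b)                ≡⟨ ^-distribʳ-* x y (a ℕ.* b) ⟩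
        x ^ (a ℕ.* b) * y ^ (a ℕ.* b)      ≈⟨ *-cong-mod (^≡1-mod-* x a b (^order≡1 ord-x)) (^≡1-mod-∣ y b (^order≡1 ord-y) (ℕ.n∣m*n a)) ⟩
        1ℤ * 1ℤ                            ≡⟨⟩
        1ℤ                                 ∎
    ; order∣   = λ j xy^j≡1 → coprime⇒*∣ a⊥b (a∣ j xy^j≡1) (b∣ j xy^j≡1)
    }
    where
    open mod-Reasoning d
    cancel-≡1 : ∀ u v e → v ^ e ≡ 1ℤ mod d → (u * v) ^ e ≡ 1ℤ mod d → u ^ e ≡ 1ℤ mod d
    cancel-≡1 u v e v^e≡1 uv^e≡1 =
      ≡1-mod-*-cancelˡ v^e≡1 (subst (_≡ 1ℤ mod d) (trans (^-distribʳ-* u v e) (ℤ.*-comm (u ^ e) (v ^ e))) uv^e≡1)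
    a∣ : ∀ j → (x * y) ^ j ≡ 1ℤ mod d → a ∣ j
    a∣ j xy^j≡1 = coprime-divisor a⊥b (subst (a ∣_) (ℕ.*-comm j b) (order∣ ord-x (j ℕ.* b) x^jb≡1))
      where
      x^jb≡1 : x ^ (j ℕ.* b) ≡ 1ℤ mod d
      x^jb≡1 = cancel-≡1 x y (j ℕ.* b) (^≡1-mod-∣ y b (^order≡1 ord-y) (ℕ.n∣m*n j)) (^≡1-mod-* (x * y) j b xy^j≡1)
    b∣ : ∀ j → (x * y) ^ j ≡ 1ℤ mod d → b ∣ j
    b∣ j xy^j≡1 = coprime-divisor (Cop.sym a⊥b) (subst (b ∣_) (ℕ.*-comm j a) (order∣ ord-y (j ℕ.* a) y^ja≡1))
      where
      yx^ja≡1 : (y * x) ^ (j ℕ.* a) ≡ 1ℤ mod d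
      yx^ja≡1 = subst (λ z → z ^ (j ℕ.* a) ≡ 1ℤ mod d) (ℤ.*-comm x y) (^≡1-mod-* (x * y) j a xy^j≡1)
      y^ja≡1 : y ^ (j ℕ.* a) ≡ 1ℤ mod d
      y^ja≡1 = cancel-≡1 y x (j ℕ.* a) (^≡1-mod-∣ x a (^order≡1 ord-x) (ℕ.n∣m*n j)) yx^ja≡1

order-exists : ∀ n .{{_ : NonZero n}} {x k} → 0 < k → x ^ k ≡ 1ℤ mod + n →
               ∃ λ m → x HasOrder m mod + n × m ≤ k
order-exists n {x} {k} k>0 x^k≡1 = from-least (least-witness returns? (k>0 , x^k≡1))
  where
  open mod-Reasoning (+ n)
  returns? : ∀ j → Dec (0 < j × x ^ j ≡ 1ℤ mod + n)
  returns? j = (0 ℕ.<? j) Dec.×-dec mod? n (x ^ j) 1ℤ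
  from-least : (∃ λ m → (0 < m × x ^ m ≡ 1ℤ mod + n) × (∀ j → j < m → ¬ (0 < j × x ^ j ≡ 1ℤ mod + n))) →
               ∃ λ m → x HasOrder m mod + n × m ≤ k
  from-least (m@(suc m′) , (_ , x^m≡1) , none-smaller) = m , ord , ℕ.∣⇒≤ {{ℕ.>-nonZero k>0}} (order∣ ord k x^k≡1)
    where
    remainder≡0 : ∀ j → x ^ j ≡ 1ℤ mod + n → j ℕ.% m ≡ 0
    remainder≡0 j x^j≡1 with j ℕ.% m in r≡
    ... | zero  = refl
    ... | suc r = ⊥-elim (none-smaller (suc r) (subst (_< m) r≡ (ℕ.m%n<n j m)) (z<s , (begin
      x ^ suc r                                      ≡⟨ ℤ.*-identityʳ _ ⟨
      x ^ suc r * 1ℤ                                 ≈⟨ *-congˡ-mod (x ^ suc r) (mod-sym (^≡1-mod-* x m (j ℕ./ m) x^m≡1)) ⟩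
      x ^ suc r * x ^ (m ℕ.* (j ℕ./ m))              ≡⟨ ℤ.^-distribˡ-+-* x (suc r) _ ⟨
      x ^ (suc r ℕ.+ m ℕ.* (j ℕ./ m))                ≡⟨ cong (x ^_) split ⟨
      x ^ j                                          ≈⟨ x^j≡1 ⟩
      1ℤ                                             ∎)))
      where
      split : j ≡ suc r ℕ.+ m ℕ.* (j ℕ./ m)
      split = trans (ℕ.m≡m%n+[m/n]*n j m) (cong₂ ℕ._+_ r≡ (ℕ.*-comm (j ℕ./ m) m))
    ord : x HasOrder m mod + n
    ord = record
      { order>0  = z<s
      ; ^order≡1 = x^m≡1
      ; order∣   = λ j x^j≡1 → ℕ.m%n≡0⇒n∣m j m (remainder≡0 j x^j≡1)
      }

-- Binomial expansions

binomial-cubic : ∀ X t → ∃ λ R → (1ℤ + X) ^ t ≡ 1ℤ + + t * X + + (t C 2) * (X * X) + X * X * X * R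
binomial-cubic X zero    = 0ℤ , constant X
  where
  constant : ∀ X → 1ℤ ≡ 1ℤ + 0ℤ * X + 0ℤ * (X * X) + X * X * X * 0ℤ
  constant = solve-∀
binomial-cubic X (suc t) with binomial-cubic X t
... | R , expansion = + (t C 2) + R + X * R , (begin
  (1ℤ + X) * (1ℤ + X) ^ t                                                         ≡⟨ cong ((1ℤ + X) *_) expansion ⟩
  (1ℤ + X) * (1ℤ + + t * X + + (t C 2) * (X * X) + X * X * X * R)                 ≡⟨ multiply-out X (+ t) (+ (t C 2)) R ⟩
  1ℤ + (1ℤ + + t) * X + (+ (t C 2) + + t) * (X * X) + X * X * X * (+ (t C 2) + R + X * R)
    ≡⟨ cong₂ (λ a b → 1ℤ + a * X + b * (X * X) + X * X * X * (+ (t C 2) + R + X * R))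
             (sym (ℤ.pos-+ 1 t)) (trans (sym (ℤ.pos-+ (t C 2) t)) (cong +_ (sym (C₂-suc t)))) ⟩
  1ℤ + + suc t * X + + (suc t C 2) * (X * X) + X * X * X * (+ (t C 2) + R + X * R) ∎)
  where
  open ≡-Reasoning
  multiply-out : ∀ X T C R → (1ℤ + X) * (1ℤ + T * X + C * (X * X) + X * X * X * R)
                 ≡ 1ℤ + (1ℤ + T) * X + (C + T) * (X * X) + X * X * X * (C + R + X * R)
  multiply-out = solve-∀

binomial-linear-mod : ∀ {q M X} t → q ∣ℤ M → M ∣ℤ X → (1ℤ + X) ^ t ≡ 1ℤ + + t * X mod q * M
binomial-linear-mod {q} t (divides l refl) (divides k refl) with binomial-cubic (k * (l * q)) t
... | R , expansion = mod-by (divides (k * k * l * (+ (t C 2) + k * (l * q) * R)) (begin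
  (1ℤ + k * (l * q)) ^ t - (1ℤ + + t * (k * (l * q)))
    ≡⟨ cong (_- (1ℤ + + t * (k * (l * q)))) expansion ⟩
  1ℤ + + t * X + + (t C 2) * (X * X) + X * X * X * R - (1ℤ + + t * X)
    ≡⟨ collect k l q (+ t) (+ (t C 2)) R ⟩
  k * k * l * (+ (t C 2) + k * (l * q) * R) * (q * (l * q))
    ∎))
  where
  open ≡-Reasoning
  X = k * (l * q)
  collect : ∀ k l q T C R →
            1ℤ + T * (k * (l * q)) + C * ((k * (l * q)) * (k * (l * q))) + (k * (l * q)) * (k * (l * q)) * (k * (l * q)) * R - (1ℤ + T * (k * (l * q)))
            ≡ k * k * l * (C + k * (l * q) * R) * (q * (l * q))
  collect = solve-∀

≡1-lift : ∀ p {M y} → + p ∣ℤ M → y ≡ 1ℤ mod M → y ^ p ≡ 1ℤ mod + p * M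
≡1-lift p {M} {y} p∣M (mod-by M∣y-1) = begin
  y ^ p                      ≡⟨ cong (_^ p) (split y) ⟩
  (1ℤ + (y - 1ℤ)) ^ p        ≈⟨ binomial-linear-mod p p∣M M∣y-1 ⟩
  1ℤ + + p * (y - 1ℤ)        ≈⟨ +-congˡ-mod 1ℤ (∣⇒≡0-mod (ℤ.*-monoʳ-∣ (+ p) M∣y-1)) ⟩
  1ℤ + 0ℤ                    ≡⟨⟩
  1ℤ                         ∎
  where
  open mod-Reasoning (+ p * M)
  split : ∀ y → y ≡ 1ℤ + (y - 1ℤ)
  split = solve-∀

-- Oddness of p is what makes C(p,2) = p (p - 1) / 2 a multiple of p.
binomial-odd-mod : ∀ {p M} s → ¬ 2 ∣ p → + p ∣ℤ M → (1ℤ + s * M) ^ p ≡ 1ℤ + + p * (s * M) mod + p * + p * M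
binomial-odd-mod {p} s 2∤p (divides l refl) with binomial-cubic (s * (l * + p)) p
... | R , expansion = mod-by (divides (+ h * s * s * l + s * s * s * l * l * R) (begin
  (1ℤ + X) ^ p - (1ℤ + P * X)                                          ≡⟨ cong (_- (1ℤ + P * X)) expansion ⟩
  1ℤ + P * X + + (p C 2) * (X * X) + X * X * X * R - (1ℤ + P * X)      ≡⟨ cong (λ c → 1ℤ + P * X + c * (X * X) + X * X * X * R - (1ℤ + P * X)) C₂p ⟩
  1ℤ + P * X + + h * P * (X * X) + X * X * X * R - (1ℤ + P * X)        ≡⟨ collect s l P (+ h) R ⟩
  (+ h * s * s * l + s * s * s * l * l * R) * (P * P * (l * P))        ∎))
  where
  open ≡-Reasoning
  P = + p
  X = s * (l * P)
  h = proj₁ (odd⇒1+2h 2∤p)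
  C₂p : + (p C 2) ≡ + h * P
  C₂p = begin
    + (p C 2)                     ≡⟨ cong (λ t → + (t C 2)) (proj₂ (odd⇒1+2h 2∤p)) ⟩
    + (suc (h ℕ.+ h) C 2)         ≡⟨ cong +_ (C₂-odd h) ⟩
    + (h ℕ.* suc (h ℕ.+ h))       ≡⟨ cong (λ t → + (h ℕ.* t)) (proj₂ (odd⇒1+2h 2∤p)) ⟨
    + (h ℕ.* p)                   ≡⟨ ℤ.pos-* h p ⟩
    + h * P                       ∎
  collect : ∀ s l P H R →
            1ℤ + P * (s * (l * P)) + H * P * ((s * (l * P)) * (s * (l * P))) + (s * (l * P)) * (s * (l * P)) * (s * (l * P)) * R - (1ℤ + P * (s * (l * P)))
            ≡ (H * s * s * l + s * s * s * l * l * R) * (P * P * (l * P))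
  collect = solve-∀

-- Primitive roots modulo a prime

-- A vector (a₀ , … , a_{d-1}) represents the monic polynomial a₀ + a₁ x + ⋯ + a_{d-1} x^{d-1} + x^d.
eval-monic : ∀ {d} → Vec ℤ d → ℤ → ℤ
eval-monic []       x = 1ℤ
eval-monic (a ∷ as) x = a + x * eval-monic as x

divide-by-root : ∀ {d} → Vec ℤ (suc d) → ℤ → Vec ℤ d
divide-by-root (a ∷ [])     r = []
divide-by-root (a ∷ b ∷ bs) r = eval-monic (b ∷ bs) r ∷ divide-by-root (b ∷ bs) r

eval-divide-by-root : ∀ {d} (f : Vec ℤ (suc d)) x r →
                      eval-monic f x ≡ eval-monic f r + (x - r) * eval-monic (divide-by-root f r) x
eval-divide-by-root (a ∷ [])     x r = linear a x r
  where
  linear : ∀ a x r → a + x * 1ℤ ≡ a + r * 1ℤ + (x - r) * 1ℤ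
  linear = solve-∀
eval-divide-by-root (a ∷ b ∷ bs) x r = begin
  a + x * eval-monic (b ∷ bs) x                     ≡⟨ cong (λ y → a + x * y) (eval-divide-by-root (b ∷ bs) x r) ⟩
  a + x * (g + (x - r) * q)                         ≡⟨ horner-step a x r g q ⟩
  a + r * g + (x - r) * (g + x * q)                 ∎
  where
  open ≡-Reasoning
  g = eval-monic (b ∷ bs) r
  q = eval-monic (divide-by-root (b ∷ bs) r) x
  horner-step : ∀ a x r g q → a + x * (g + (x - r) * q) ≡ a + r * g + (x - r) * (g + x * q)
  horner-step = solve-∀

x^[1+m]-1 : ∀ m → Vec ℤ (suc m)
x^[1+m]-1 m = - 1ℤ ∷ replicate m 0ℤ

eval-x^[1+m]-1 : ∀ m x → eval-monic (x^[1+m]-1 m) x ≡ x ^ suc m - 1ℤ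
eval-x^[1+m]-1 m x = trans (cong (λ y → - 1ℤ + x * y) (eval-zeros m)) (ℤ.+-comm (- 1ℤ) (x ^ suc m))
  where
  eval-zeros : ∀ k → eval-monic (replicate k 0ℤ) x ≡ x ^ k
  eval-zeros zero    = refl
  eval-zeros (suc k) = trans (ℤ.+-identityˡ _) (cong (x *_) (eval-zeros k))

module ModPrime {p : ℕ} (prime-p : Prime p) where

  instance
    p≢0 : NonZero p
    p≢0 = prime⇒nonZero prime-p

  P : ℤ
  P = + p

  ∣*⇒∣⊎∣ : ∀ {a b} → P ∣ℤ a * b → P ∣ℤ a ⊎ P ∣ℤ b
  ∣*⇒∣⊎∣ {a} {b} P∣ab with euclidsLemma ℤ.∣ a ∣ ℤ.∣ b ∣ prime-p (subst (p ∣_) (ℤ.abs-* a b) (ℤ.∣⇒∣ᵤ P∣ab))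
  ... | inj₁ p∣a = inj₁ (ℤ.∣ᵤ⇒∣ p∣a)
  ... | inj₂ p∣b = inj₂ (ℤ.∣ᵤ⇒∣ p∣b)

  ∤-positive : ∀ {k} → 0 < k → k < p → ¬ P ∣ℤ + k
  ∤-positive {suc k} _ k<p P∣k = ℕ.<⇒≱ k<p (ℕ.∣⇒≤ (ℤ.∣⇒∣ᵤ P∣k))

  ∤1 : ¬ P ∣ℤ 1ℤ
  ∤1 = ∤-positive z<s (prime>1 prime-p)

  ∤-* : ∀ {a b} → ¬ P ∣ℤ a → ¬ P ∣ℤ b → ¬ P ∣ℤ a * b
  ∤-* P∤a P∤b P∣ab = [ P∤a , P∤b ]′ (∣*⇒∣⊎∣ P∣ab)

  ∤-^ : ∀ {a} → ¬ P ∣ℤ a → ∀ n → ¬ P ∣ℤ a ^ n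
  ∤-^ P∤a zero    = ∤1
  ∤-^ P∤a (suc n) = ∤-* P∤a (∤-^ P∤a n)

  ∤-resp-mod : ∀ {x y} → x ≡ y mod P → ¬ P ∣ℤ x → ¬ P ∣ℤ y
  ∤-resp-mod x≡y P∤x P∣y = P∤x (≡0-mod⇒∣ (mod-trans x≡y (∣⇒≡0-mod P∣y)))

  *-cancelˡ-mod : ∀ {a x y} → ¬ P ∣ℤ a → a * x ≡ a * y mod P → x ≡ y mod P
  *-cancelˡ-mod {a} {x} {y} P∤a (mod-by P∣ax-ay)
    with ∣*⇒∣⊎∣ (subst (P ∣ℤ_) (factor a x y) P∣ax-ay)
    where
    factor : ∀ a x y → a * x - a * y ≡ a * (x - y)
    factor = solve-∀
  ... | inj₁ P∣a   = ⊥-elim (P∤a P∣a)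
  ... | inj₂ P∣x-y = mod-by P∣x-y

  ^-cancel-mod : ∀ {x} i j → ¬ P ∣ℤ x → x ^ i ≡ x ^ (i ℕ.+ j) mod P → x ^ j ≡ 1ℤ mod P
  ^-cancel-mod {x} i j P∤x x^i≡x^i+j = mod-sym (*-cancelˡ-mod (∤-^ P∤x i) (begin
    x ^ i * 1ℤ       ≡⟨ ℤ.*-identityʳ (x ^ i) ⟩
    x ^ i            ≈⟨ x^i≡x^i+j ⟩
    x ^ (i ℕ.+ j)    ≡⟨ ℤ.^-distribˡ-+-* x i j ⟩
    x ^ i * x ^ j    ∎))
    where open mod-Reasoning P

  ∤⇒residue≢0 : ∀ {x} → ¬ P ∣ℤ x → x %ℕ p ≢ 0
  ∤⇒residue≢0 {x} P∤x r≡0 = P∤x (≡0-mod⇒∣ (%ℕ-≡⇒mod p x 0ℤ (trans r≡0 (sym (ℕ.m*n%n≡0 0 p)))))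

  pred-residue< : ∀ {x} → ¬ P ∣ℤ x → ℕ.pred (x %ℕ p) < ℕ.pred p
  pred-residue< {x} P∤x = pred-< (∤⇒residue≢0 P∤x) (ℤ.n%ℕd<d x p)

  -- Pigeonhole: the residues of x⁰, …, x^{p-1} all lie in 1, …, p - 1.
  power≡1 : ∀ {x} → ¬ P ∣ℤ x → ∃ λ k → 0 < k × k < p × x ^ k ≡ 1ℤ mod P
  power≡1 {x} P∤x = from-collision (FinP.pigeonhole (ℕ.m≤pred[n]⇒suc[m]≤n {n = p} ℕ.≤-refl) shifted-residue)
    where
    shifted-residue : Fin p → Fin (ℕ.pred p)
    shifted-residue i = fromℕ< (pred-residue< (∤-^ P∤x (toℕ i)))
    from-collision : (∃₂ λ i j → i Fin.< j × shifted-residue i ≡ shifted-residue j) →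
                     ∃ λ k → 0 < k × k < p × x ^ k ≡ 1ℤ mod P
    from-collision (i , j , i<j , same-shift) = toℕ j ℕ.∸ toℕ i , ℕ.m<n⇒0<n∸m i<j ,
        ℕ.≤-<-trans (ℕ.m∸n≤m (toℕ j) (toℕ i)) (FinP.toℕ<n j) ,
        ^-cancel-mod (toℕ i) (toℕ j ℕ.∸ toℕ i) P∤x
          (mod-trans (%ℕ-≡⇒mod p (x ^ toℕ i) (x ^ toℕ j) same-residue)
                     (mod-reflexive (cong (x ^_) (sym (ℕ.m+[n∸m]≡n {toℕ i} {toℕ j} (ℕ.<⇒≤ i<j))))))
      where
      P∤xⁱ = ∤-^ P∤x (toℕ i)
      P∤xʲ = ∤-^ P∤x (toℕ j)
      same-residue : (x ^ toℕ i) %ℕ p ≡ (x ^ toℕ j) %ℕ p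
      same-residue = pred-injective (∤⇒residue≢0 P∤xⁱ) (∤⇒residue≢0 P∤xʲ)
        (trans (sym (FinP.toℕ-fromℕ< (pred-residue< P∤xⁱ)))
               (trans (cong toℕ same-shift) (FinP.toℕ-fromℕ< (pred-residue< P∤xʲ))))

  order⇒∤ : ∀ {x m} → x HasOrder m mod P → ¬ P ∣ℤ x
  order⇒∤ {x} {m} ord P∣x with order>0 ord
  ... | z<s {n = m′} = ∤1 (≡0-mod⇒∣ (begin
    1ℤ             ≈⟨ mod-sym (^order≡1 ord) ⟩
    x * x ^ m′     ≈⟨ *-congʳ-mod (x ^ m′) (∣⇒≡0-mod P∣x) ⟩
    0ℤ * x ^ m′    ≡⟨ ℤ.*-zeroˡ (x ^ m′) ⟩
    0ℤ             ∎))
    where open mod-Reasoning P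

  order< : ∀ {x m} → x HasOrder m mod P → m < p
  order< {x} {m} ord = bound (power≡1 (order⇒∤ ord))
    where
    bound : (∃ λ k → 0 < k × k < p × x ^ k ≡ 1ℤ mod P) → m < p
    bound (k , k>0 , k<p , x^k≡1) = ℕ.≤-<-trans (ℕ.∣⇒≤ {{ℕ.>-nonZero k>0}} (order∣ ord k x^k≡1)) k<p

  order-mod-prime : ∀ {x} → ¬ P ∣ℤ x → ∃ λ m → x HasOrder m mod P
  order-mod-prime {x} P∤x = order-of-power (power≡1 P∤x)
    where
    order-of-power : (∃ λ k → 0 < k × k < p × x ^ k ≡ 1ℤ mod P) → ∃ λ m → x HasOrder m mod P
    order-of-power (k , k>0 , _ , x^k≡1) = let m , ord , _ = order-exists p k>0 x^k≡1 in m , ord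

  larger-order : ∀ {c x r s} → c HasOrder r mod P → x HasOrder s mod P → ¬ s ∣ r →
                 ∃₂ λ c′ r′ → c′ HasOrder r′ mod P × r < r′
  larger-order {c} {x} {r} {s} ord-c ord-x s∤r = use-prime-power (∤⇒prime-power-∤ s r s∤r)
    where
    instance
      r≢0 : NonZero r
      r≢0 = ℕ.>-nonZero (order>0 ord-c)
      s≢0 : NonZero s
      s≢0 = ℕ.>-nonZero (order>0 ord-x)
    use-prime-power : (∃₂ λ q e → Prime q × q ℕ.^ e ∣ s × ¬ q ℕ.^ e ∣ r) → ∃₂ λ c′ r′ → c′ HasOrder r′ mod P × r < r′
    use-prime-power (q , e , prime-q , divides t s≡t*q^e , q^e∤r) = split-r (prime-power-split prime-q r)
      where
      split-r : (∃₂ λ f r₁ → r ≡ q ℕ.^ f ℕ.* r₁ × ¬ q ∣ r₁) → ∃₂ λ c′ r′ → c′ HasOrder r′ mod P × r < r′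
      split-r (f , r₁ , r≡q^f*r₁ , q∤r₁) =
        c ^ (q ℕ.^ f) * x ^ t , r₁ ℕ.* q ℕ.^ e ,
        order-of-* (order-of-^ (q ℕ.^ f) r₁ (subst (c HasOrder_mod P) r≡q^f*r₁ ord-c))
                   (order-of-^ t (q ℕ.^ e) (subst (x HasOrder_mod P) s≡t*q^e ord-x))
                   (prime∤⇒coprime-^ prime-q q∤r₁ e) ,
        subst (_< r₁ ℕ.* q ℕ.^ e) (sym r≡r₁*q^f) (ℕ.*-monoʳ-< r₁ {{r₁≢0}} (ℕ.^-monoʳ-< q (prime>1 prime-q) f<e))
        where
        r≡r₁*q^f : r ≡ r₁ ℕ.* q ℕ.^ f
        r≡r₁*q^f = trans r≡q^f*r₁ (ℕ.*-comm (q ℕ.^ f) r₁)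
        r₁≢0 : NonZero r₁
        r₁≢0 = ℕ.m*n≢0⇒m≢0 r₁ {{subst NonZero r≡r₁*q^f r≢0}}
        f<e : f < e
        f<e = ℕ.≰⇒> λ e≤f → q^e∤r (ℕ.∣-trans (^-∣-^ q e≤f) (divides r₁ r≡r₁*q^f))

  Exponent : ℕ → Set
  Exponent r = ∀ x → ¬ P ∣ℤ x → x ^ r ≡ 1ℤ mod P

  exponent-from-residues : ∀ r → (∀ (i : Fin p) → P ∣ℤ + toℕ i ⊎ (+ toℕ i) ^ r ≡ 1ℤ mod P) → Exponent r
  exponent-from-residues r residues-ok x P∤x =
    [ (λ P∣i → ⊥-elim (∤-resp-mod x≡i P∤x P∣i)) , mod-trans (^-cong-mod r x≡i) ]′ (residues-ok i)
    where
    i : Fin p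
    i = fromℕ< (ℤ.n%ℕd<d x p)
    x≡i : x ≡ + toℕ i mod P
    x≡i = subst (λ k → x ≡ + k mod P) (sym (FinP.toℕ-fromℕ< (ℤ.n%ℕd<d x p))) (%ℕ-mod x p)

  -- The order of c grows strictly and stays below p, until it annihilates every unit.
  exponent-element : ∃₂ λ c m → c HasOrder m mod P × Exponent m
  exponent-element = grow order-of-1 (<-wellFounded (p ℕ.∸ 1))
    where
    order-of-1 : 1ℤ HasOrder 1 mod P
    order-of-1 = record { order>0 = z<s ; ^order≡1 = mod-reflexive refl ; order∣ = λ j _ → ℕ.1∣ j }
    residue-ok? : ∀ r (i : Fin p) → Dec (P ∣ℤ + toℕ i ⊎ (+ toℕ i) ^ r ≡ 1ℤ mod P)
    residue-ok? r i = (P ℤ.∣? + toℕ i) Dec.⊎-dec mod? p ((+ toℕ i) ^ r) 1ℤ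
    grow : ∀ {c r} → c HasOrder r mod P → Acc _<_ (p ℕ.∸ r) → ∃₂ λ c m → c HasOrder m mod P × Exponent m
    grow {c} {r} ord-c (acc rec) with FinP.all? (residue-ok? r)
    ... | yes all-ok = c , r , ord-c , exponent-from-residues r all-ok
    ... | no ¬all-ok = enlarge (FinP.¬∀⟶∃¬ p _ (residue-ok? r) ¬all-ok)
      where
      enlarge : (∃ λ i → ¬ (P ∣ℤ + toℕ i ⊎ (+ toℕ i) ^ r ≡ 1ℤ mod P)) → ∃₂ λ c m → c HasOrder m mod P × Exponent m
      enlarge (i , bad) = continue (larger-order ord-c ord-x s∤r)
        where
        s = proj₁ (order-mod-prime (bad ∘ inj₁))
        ord-x = proj₂ (order-mod-prime (bad ∘ inj₁))
        s∤r : ¬ s ∣ r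
        s∤r s∣r = bad (inj₂ (^≡1-mod-∣ (+ toℕ i) s (^order≡1 ord-x) s∣r))
        continue : (∃₂ λ c′ r′ → c′ HasOrder r′ mod P × r < r′) → ∃₂ λ c m → c HasOrder m mod P × Exponent m
        continue (c′ , r′ , ord-c′ , r<r′) = grow ord-c′ (rec (ℕ.∸-monoʳ-< r<r′ (ℕ.<⇒≤ (order< ord-c′))))

  monic-root-bound : ∀ d (f : Vec ℤ d) (r : Fin (suc d) → ℤ) →
                     (∀ i → eval-monic f (r i) ≡ 0ℤ mod P) → (∀ i j → r i ≡ r j mod P → i ≡ j) → ⊥
  monic-root-bound zero    []  r roots _        = ∤1 (≡0-mod⇒∣ (roots Fin.zero))
  monic-root-bound (suc d) f   r roots distinct =
    monic-root-bound d (divide-by-root f r₀) (r ∘ Fin.suc) quotient-roots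
      (λ i j rᵢ≡rⱼ → FinP.suc-injective (distinct (Fin.suc i) (Fin.suc j) rᵢ≡rⱼ))
    where
    r₀ = r Fin.zero
    quotient-roots : ∀ i → eval-monic (divide-by-root f r₀) (r (Fin.suc i)) ≡ 0ℤ mod P
    quotient-roots i = [ (λ P∣rᵢ-r₀ → ⊥-elim (case distinct (Fin.suc i) Fin.zero (mod-by P∣rᵢ-r₀) of λ ())) ,
                         ∣⇒≡0-mod ]′ (∣*⇒∣⊎∣ (≡0-mod⇒∣ product≡0))
      where
      open mod-Reasoning P
      rᵢ = r (Fin.suc i)
      isolate : ∀ u v w → u ≡ v + w → w ≡ u - v
      isolate u v w refl = cancel v w
        where
        cancel : ∀ v w → w ≡ v + w - v
        cancel = solve-∀
      product≡0 : (rᵢ - r₀) * eval-monic (divide-by-root f r₀) rᵢ ≡ 0ℤ mod P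
      product≡0 = begin
        (rᵢ - r₀) * eval-monic (divide-by-root f r₀) rᵢ   ≡⟨ isolate _ _ _ (eval-divide-by-root f rᵢ r₀) ⟩
        eval-monic f rᵢ - eval-monic f r₀                 ≈⟨ +-cong-mod (roots (Fin.suc i)) (-‿cong-mod (roots Fin.zero)) ⟩
        0ℤ - 0ℤ                                           ≡⟨⟩
        0ℤ                                                ∎

  ^-≡⇒order∣∸ : ∀ {x m} a b → x HasOrder m mod P → a ≤ b → x ^ a ≡ x ^ b mod P → m ∣ b ℕ.∸ a
  ^-≡⇒order∣∸ {x} a b ord a≤b x^a≡x^b = order∣ ord (b ℕ.∸ a) (^-cancel-mod a (b ℕ.∸ a) (order⇒∤ ord)
    (subst (λ e → x ^ a ≡ x ^ e mod P) (sym (ℕ.m+[n∸m]≡n a≤b)) x^a≡x^b))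

  powers-distinct : ∀ {x m} i j → x HasOrder m mod P → i < m → j < m → x ^ i ≡ x ^ j mod P → i ≡ j
  powers-distinct i j ord i<m j<m x^i≡x^j with ℕ.≤-total i j
  ... | inj₁ i≤j = ℕ.≤-antisym i≤j (ℕ.m∸n≡0⇒m≤n (∣∧<⇒≡0 (^-≡⇒order∣∸ i j ord i≤j x^i≡x^j)
                     (ℕ.≤-<-trans (ℕ.m∸n≤m j i) j<m)))
  ... | inj₂ j≤i = sym (ℕ.≤-antisym j≤i (ℕ.m∸n≡0⇒m≤n (∣∧<⇒≡0 (^-≡⇒order∣∸ j i ord j≤i (mod-sym x^i≡x^j))
                     (ℕ.≤-<-trans (ℕ.m∸n≤m i j) i<m))))

  power-root-bound : ∀ m (r : Fin (suc (suc m)) → ℤ) → (∀ i → r i ^ suc m ≡ 1ℤ mod P) →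
                     (∀ i j → r i ≡ r j mod P → i ≡ j) → ⊥
  power-root-bound m r roots = monic-root-bound (suc m) (x^[1+m]-1 m) r λ i →
    subst (_≡ 0ℤ mod P) (sym (eval-x^[1+m]-1 m (r i))) (∣⇒≡0-mod (modulus∣difference (roots i)))

  record PrimitiveRoot : Set where
    field
      root      : ℤ
      order     : root HasOrder ℕ.pred p mod P
      generates : ∀ x → ¬ P ∣ℤ x → ∃ λ i → x ≡ root ^ i mod P

  -- Every unit is a root of x^m - 1 when m is the order of the exponent element c; the roots 1, …, p - 1
  -- force m = p - 1, and the m distinct roots c⁰, …, c^{m-1} leave no room for another unit.
  primitive-root : PrimitiveRoot
  primitive-root = from-exponent-element exponent-element
    where
    from-exponent-element : (∃₂ λ c m → c HasOrder m mod P × Exponent m) → PrimitiveRoot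
    from-exponent-element (c , zero , ord-c , _) = ⊥-elim (ℕ.<-irrefl refl (order>0 ord-c))
    from-exponent-element (c , suc m′ , ord-c , exponent-m) =
      record { root = c ; order = subst (c HasOrder_mod P) m≡p-1 ord-c ; generates = generated }
      where
      p-1≤m : ℕ.pred p ≤ suc m′
      p-1≤m = ℕ.≮⇒≥ λ m<p-1 → power-root-bound m′ (λ i → + suc (toℕ i))
        (λ i → exponent-m _ (∤-positive z<s (small i m<p-1)))
        (λ i j i≡j → FinP.toℕ-injective (ℕ.suc-injective (residue-unique (small i m<p-1) (small j m<p-1) i≡j)))
        where
        small : ∀ (i : Fin (suc (suc m′))) → suc m′ < ℕ.pred p → suc (toℕ i) < p
        small i m<p-1 = ℕ.m≤pred[n]⇒suc[m]≤n (ℕ.≤-trans (FinP.toℕ<n i) m<p-1)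
      m≡p-1 : suc m′ ≡ ℕ.pred p
      m≡p-1 = ℕ.≤-antisym (ℕ.suc[m]≤n⇒m≤pred[n] (order< ord-c)) p-1≤m
      generated : ∀ x → ¬ P ∣ℤ x → ∃ λ i → x ≡ c ^ i mod P
      generated x P∤x with FinP.any? (λ (i : Fin (suc m′)) → mod? p x (c ^ toℕ i))
      ... | yes (i , x≡cⁱ) = toℕ i , x≡cⁱ
      ... | no x-not-power = ⊥-elim (power-root-bound m′ root roots distinct)
        where
        root : Fin (suc (suc m′)) → ℤ
        root Fin.zero    = x
        root (Fin.suc i) = c ^ toℕ i
        roots : ∀ i → root i ^ suc m′ ≡ 1ℤ mod P
        roots Fin.zero    = exponent-m x P∤x
        roots (Fin.suc i) = exponent-m (c ^ toℕ i) (∤-^ (order⇒∤ ord-c) (toℕ i))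
        distinct : ∀ i j → root i ≡ root j mod P → i ≡ j
        distinct Fin.zero    Fin.zero    _   = refl
        distinct Fin.zero    (Fin.suc j) x≡cʲ = ⊥-elim (x-not-power (j , x≡cʲ))
        distinct (Fin.suc i) Fin.zero    cⁱ≡x = ⊥-elim (x-not-power (i , mod-sym cⁱ≡x))
        distinct (Fin.suc i) (Fin.suc j) cⁱ≡cʲ =
          cong Fin.suc (FinP.toℕ-injective (powers-distinct (toℕ i) (toℕ j) ord-c (FinP.toℕ<n i) (FinP.toℕ<n j) cⁱ≡cʲ))

  -- If x² ≡ g and x ≡ gⁱ, then g^{2i} ≡ g, making the even number 2i congruent to 1 modulo the even order p - 1.
  primitive-root-non-square : ¬ 2 ∣ p → (g : PrimitiveRoot) → ∀ x → ¬ x * x ≡ PrimitiveRoot.root g mod P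
  primitive-root-non-square 2∤p g x x²≡g = from-index (generates x P∤x)
    where
    open PrimitiveRoot g
    open mod-Reasoning P
    P∤x : ¬ P ∣ℤ x
    P∤x P∣x = order⇒∤ order (≡0-mod⇒∣ (mod-trans (mod-sym x²≡g) (∣⇒≡0-mod (ℤ.∣m⇒∣m*n x P∣x))))
    double : ∀ i → i ℕ.+ i ≡ i ℕ.* 2
    double = ℕ.solve-∀
    2∣p-1 : 2 ∣ ℕ.pred p
    2∣p-1 = [ id , (λ 2∣p → ⊥-elim (2∤p (subst (2 ∣_) (ℕ.suc-pred p) 2∣p))) ]′ (2∣n⊎2∣1+n (ℕ.pred p))
    even-power-≢-root : ∀ e → root ^ e ≡ root ^ 1 mod P → 2 ∣ e → ⊥
    even-power-≢-root zero    g⁰≡g _ = 2∤p (subst (2 ∣_) p-1≡1⇒p≡2 ℕ.∣-refl)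
      where
      p-1≡1⇒p≡2 : 2 ≡ p
      p-1≡1⇒p≡2 = trans (cong suc (sym (ℕ.∣1⇒≡1 (^-≡⇒order∣∸ 0 1 order z≤n g⁰≡g)))) (ℕ.suc-pred p)
    even-power-≢-root (suc k) gᵏ⁺¹≡g 2∣1+k = 2∤1 (ℕ.∣m+n∣m⇒∣n (subst (2 ∣_) (ℕ.+-comm 1 k) 2∣1+k)
      (ℕ.∣-trans 2∣p-1 (^-≡⇒order∣∸ 1 (suc k) order (s≤s z≤n) (mod-sym gᵏ⁺¹≡g))))
    from-index : (∃ λ i → x ≡ root ^ i mod P) → ⊥
    from-index (i , x≡gⁱ) = even-power-≢-root (i ℕ.+ i) g^[i+i]≡g (divides i (double i))
      where
      g^[i+i]≡g : root ^ (i ℕ.+ i) ≡ root ^ 1 mod P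
      g^[i+i]≡g = begin
        root ^ (i ℕ.+ i)         ≡⟨ ℤ.^-distribˡ-+-* root i i ⟩
        root ^ i * root ^ i      ≈⟨ *-cong-mod (mod-sym x≡gⁱ) (mod-sym x≡gⁱ) ⟩
        x * x                    ≈⟨ x²≡g ⟩
        root                     ≡⟨ ℤ.*-identityʳ root ⟨
        root ^ 1                 ∎

-- Primitive roots modulo odd prime powers

module OddPrimePower {p : ℕ} (prime-p : Prime p) (2∤p : ¬ 2 ∣ p) where

  open ModPrime prime-p
  open PrimitiveRoot primitive-root renaming (root to g; order to order-g)

  p-1 : ℕ
  p-1 = ℕ.pred p

  p≡1+[p-1] : p ≡ suc p-1
  p≡1+[p-1] = sym (ℕ.suc-pred p)

  P∣P^[1+j] : ∀ j → P ∣ℤ P ^ suc j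
  P∣P^[1+j] j = ℤ.∣m⇒∣m*n (P ^ j) (ℤ.∣-refl {P})

  fermat : ∀ {x} → ¬ P ∣ℤ x → x ^ p-1 ≡ 1ℤ mod P
  fermat {x} P∤x = via-index (generates x P∤x)
    where
    via-index : (∃ λ i → x ≡ g ^ i mod P) → x ^ p-1 ≡ 1ℤ mod P
    via-index (i , x≡gⁱ) = mod-trans (^-cong-mod p-1 x≡gⁱ)
      (subst (_≡ 1ℤ mod P) (sym (ℤ.^-*-assoc g i p-1)) (^≡1-mod-∣ g p-1 (^order≡1 order-g) (ℕ.n∣m*n i)))

  ^-p^k-mod : ∀ {M} x k → x ^ p-1 ≡ 1ℤ mod M → x ^ (p ℕ.^ k) ≡ x mod M
  ^-p^k-mod {M} x k x^[p-1]≡1 with power≡1+multiple-of-pred p-1 k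
  ... | K , [1+p-1]^k≡1+[p-1]K = subst (λ e → x ^ e ≡ x mod M)
        (sym (trans (cong (ℕ._^ k) p≡1+[p-1]) [1+p-1]^k≡1+[p-1]K)) (^-suc-multiple x p-1 K x^[p-1]≡1)

  ^-p^-suc : ∀ y j → (y ^ (p ℕ.^ j)) ^ p ≡ y ^ (p ℕ.^ suc j)
  ^-p^-suc y j = trans (ℤ.^-*-assoc y (p ℕ.^ j) p) (cong (y ^_) (ℕ.*-comm (p ℕ.^ j) p))

  ≡1-lift-^ : ∀ {y} → y ≡ 1ℤ mod P → ∀ j → y ^ (p ℕ.^ j) ≡ 1ℤ mod P ^ suc j
  ≡1-lift-^ {y} y≡1 zero    = subst (λ d → y ^ 1 ≡ 1ℤ mod d) (sym (ℤ.*-identityʳ P))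
                                 (subst (_≡ 1ℤ mod P) (sym (ℤ.*-identityʳ y)) y≡1)
  ≡1-lift-^ {y} y≡1 (suc j) = subst (_≡ 1ℤ mod P ^ suc (suc j)) (^-p^-suc y j)
                                 (≡1-lift p (P∣P^[1+j] j) (≡1-lift-^ y≡1 j))

  w : ℤ
  w = (1ℤ + P) ^ p-1

  1+P≡1 : 1ℤ + P ≡ 1ℤ mod P
  1+P≡1 = mod-by (subst (P ∣ℤ_) (cancel P) (ℤ.∣-refl {P}))
    where
    cancel : ∀ P → P ≡ 1ℤ + P - 1ℤ
    cancel = solve-∀

  w≡1 : w ≡ 1ℤ mod P
  w≡1 = subst (w ≡_mod P) (ℤ.^-zeroˡ p-1) (^-cong-mod p-1 1+P≡1)

  w-lift : ∀ j → ∃ λ s → ¬ P ∣ℤ s × w ^ (p ℕ.^ j) ≡ 1ℤ + s * P ^ suc j mod P ^ suc (suc j)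
  w-lift zero = + p-1 , ∤-positive (ℕ.suc[m]≤n⇒m≤pred[n] (prime>1 prime-p)) (ℕ.m≤pred[n]⇒suc[m]≤n {n = p} ℕ.≤-refl) ,
    subst₂ (λ d e → w ^ 1 ≡ 1ℤ + + p-1 * e mod d) (cong (P *_) (sym (ℤ.*-identityʳ P))) (sym (ℤ.*-identityʳ P))
      (subst (_≡ 1ℤ + + p-1 * P mod P * P) (sym (ℤ.*-identityʳ w))
        (binomial-linear-mod p-1 (ℤ.∣-refl {P}) (ℤ.∣-refl {P})))
  w-lift (suc j) = lift-once (w-lift j)
    where
    M = P ^ suc j
    lift-once : (∃ λ s → ¬ P ∣ℤ s × w ^ (p ℕ.^ j) ≡ 1ℤ + s * M mod P * M) →
                ∃ λ s → ¬ P ∣ℤ s × w ^ (p ℕ.^ suc j) ≡ 1ℤ + s * (P * M) mod P * (P * M)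
    lift-once (s , P∤s , mod-by (divides t u-[1+sM]≡t[PM])) = s + t * P , P∤s+tP , (begin
      w ^ (p ℕ.^ suc j)                ≡⟨ ^-p^-suc w j ⟨
      (w ^ (p ℕ.^ j)) ^ p              ≡⟨ cong (_^ p) u≡1+[s+tP]M ⟩
      (1ℤ + (s + t * P) * M) ^ p       ≈⟨ subst (λ d → (1ℤ + (s + t * P) * M) ^ p ≡ 1ℤ + P * ((s + t * P) * M) mod d)
                                              (ℤ.*-assoc P P M) (binomial-odd-mod (s + t * P) 2∤p (P∣P^[1+j] j)) ⟩
      1ℤ + P * ((s + t * P) * M)       ≡⟨ cong (λ e → 1ℤ + e) (swap P (s + t * P) M) ⟩
      1ℤ + (s + t * P) * (P * M)       ∎)
      where
      open mod-Reasoning (P * (P * M))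
      swap : ∀ a b c → a * (b * c) ≡ b * (a * c)
      swap = solve-∀
      u≡1+[s+tP]M : w ^ (p ℕ.^ j) ≡ 1ℤ + (s + t * P) * M
      u≡1+[s+tP]M = solve-for (w ^ (p ℕ.^ j)) s t P M u-[1+sM]≡t[PM]
        where
        solve-for : ∀ u s t P M → u - (1ℤ + s * M) ≡ t * (P * M) → u ≡ 1ℤ + (s + t * P) * M
        solve-for u s t P M eq = trans (rearrange u s M) (trans (cong (λ d → 1ℤ + s * M + d) eq) (collect s t P M))
          where
          rearrange : ∀ u s M → u ≡ 1ℤ + s * M + (u - (1ℤ + s * M))
          rearrange = solve-∀
          collect : ∀ s t P M → 1ℤ + s * M + t * (P * M) ≡ 1ℤ + (s + t * P) * M
          collect = solve-∀
      P∤s+tP : ¬ P ∣ℤ s + t * P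
      P∤s+tP P∣s+tP = P∤s (ℤ.∣m+n∣n⇒∣m P∣s+tP (ℤ.∣n⇒∣m*n t (ℤ.∣-refl {P})))

  p-2 : ℕ
  p-2 = ℕ.pred p-1

  p-1≡1+[p-2] : p-1 ≡ suc p-2
  p-1≡1+[p-2] = sym (ℕ.suc-pred p-1 {{ℕ.>-nonZero (ℕ.suc[m]≤n⇒m≤pred[n] (prime>1 prime-p))}})

  inverse-mod : ∀ {s} → ¬ P ∣ℤ s → s * s ^ p-2 ≡ 1ℤ mod P
  inverse-mod {s} P∤s = subst (_≡ 1ℤ mod P) (cong (s ^_) p-1≡1+[p-2]) (fermat P∤s)

  -- From b ≡ w^m (mod p^{j+1}), multiply by w^E with m + E a multiple of p^{j+1} to get v ≡ 1 + c p^{j+1};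
  -- since w^{p^j} ≡ 1 + s p^{j+1} with p ∤ s, the power (w^{p^j})^τ with τ s ≡ c (mod p) matches v modulo p^{j+2}.
  ≡1⇒power-of-w : ∀ {b} → b ≡ 1ℤ mod P → ∀ j → ∃ λ m → b ≡ w ^ m mod P ^ suc j
  ≡1⇒power-of-w {b} b≡1 zero    = 0 , subst (b ≡ 1ℤ mod_) (sym (ℤ.*-identityʳ P)) b≡1
  ≡1⇒power-of-w {b} b≡1 (suc j) = lift-exponent (≡1⇒power-of-w b≡1 j) (w-lift j) (power≡1+multiple-of-pred p-1 (suc j))
    where
    M = P ^ suc j
    lift-exponent : (∃ λ m → b ≡ w ^ m mod M) → (∃ λ s → ¬ P ∣ℤ s × w ^ (p ℕ.^ j) ≡ 1ℤ + s * M mod P * M) →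
                    (∃ λ K → suc p-1 ℕ.^ suc j ≡ suc (p-1 ℕ.* K)) → ∃ λ m → b ≡ w ^ m mod P * M
    lift-exponent (m , b≡wᵐ) (s , P∤s , u≡1+sM) (K , p^[1+j]≡1+[p-1]K) = p ℕ.^ j ℕ.* τ ℕ.+ m , b≡wᵐ′
      where
      E = m ℕ.* (p-1 ℕ.* K)
      v = b * w ^ E
      regroup : ∀ b x y → b * (x * y) ≡ b * y * x
      regroup = solve-∀
      w^[m+E]≡1 : w ^ (m ℕ.+ E) ≡ 1ℤ mod P * M
      w^[m+E]≡1 = subst (λ e → w ^ e ≡ 1ℤ mod P * M) m*p^[1+j]≡m+E
        (^≡1-mod-∣ w (p ℕ.^ suc j) (≡1-lift-^ w≡1 (suc j)) (ℕ.n∣m*n m))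
        where
        m*p^[1+j]≡m+E : m ℕ.* p ℕ.^ suc j ≡ m ℕ.+ E
        m*p^[1+j]≡m+E = trans (cong (λ q → m ℕ.* q ℕ.^ suc j) p≡1+[p-1])
                          (trans (cong (m ℕ.*_) p^[1+j]≡1+[p-1]K) (ℕ.*-suc m (p-1 ℕ.* K)))
      v≡1 : v ≡ 1ℤ mod M
      v≡1 = begin
        b * w ^ E          ≈⟨ *-congʳ-mod (w ^ E) b≡wᵐ ⟩
        w ^ m * w ^ E      ≡⟨ ℤ.^-distribˡ-+-* w m E ⟨
        w ^ (m ℕ.+ E)      ≈⟨ mod-∣ (ℤ.∣n⇒∣m*n P (ℤ.∣-refl {M})) w^[m+E]≡1 ⟩
        1ℤ                 ∎
        where open mod-Reasoning M
      c = _∣ℤ_.quotient (modulus∣difference v≡1)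
      v≡1+cM : v ≡ 1ℤ + c * M
      v≡1+cM = trans (split v) (cong (λ e → 1ℤ + e) (_∣ℤ_.equality (modulus∣difference v≡1)))
        where
        split : ∀ v → v ≡ 1ℤ + (v - 1ℤ)
        split = solve-∀
      τ = (c * s ^ p-2) %ℕ p
      τs≡c : + τ * s ≡ c mod P
      τs≡c = begin
        + τ * s                       ≈⟨ *-congʳ-mod s (mod-sym (%ℕ-mod (c * s ^ p-2) p)) ⟩
        c * s ^ p-2 * s        ≡⟨ swap c (s ^ p-2) s ⟩
        c * (s * s ^ p-2)      ≈⟨ *-congˡ-mod c (inverse-mod P∤s) ⟩
        c * 1ℤ                        ≡⟨ ℤ.*-identityʳ c ⟩
        c                             ∎
        where
        open mod-Reasoning P
        swap : ∀ c σ s → c * σ * s ≡ c * (s * σ)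
        swap = solve-∀
      uᵗ≡v : (w ^ (p ℕ.^ j)) ^ τ ≡ v mod P * M
      uᵗ≡v = begin
        (w ^ (p ℕ.^ j)) ^ τ          ≈⟨ ^-cong-mod τ u≡1+sM ⟩
        (1ℤ + s * M) ^ τ             ≈⟨ binomial-linear-mod τ (P∣P^[1+j] j) (ℤ.∣n⇒∣m*n s (ℤ.∣-refl {M})) ⟩
        1ℤ + + τ * (s * M)           ≡⟨ cong (λ e → 1ℤ + e) (ℤ.*-assoc (+ τ) s M) ⟨
        1ℤ + + τ * s * M             ≈⟨ +-congˡ-mod 1ℤ (*-scale-mod M τs≡c) ⟩
        1ℤ + c * M                   ≡⟨ v≡1+cM ⟨
        v                            ∎
        where open mod-Reasoning (P * M)
      b≡wᵐ′ : b ≡ w ^ (p ℕ.^ j ℕ.* τ ℕ.+ m) mod P * M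
      b≡wᵐ′ = begin
        b                                  ≡⟨ ℤ.*-identityʳ b ⟨
        b * 1ℤ                             ≈⟨ *-congˡ-mod b (mod-sym w^[m+E]≡1) ⟩
        b * w ^ (m ℕ.+ E)                  ≡⟨ cong (b *_) (ℤ.^-distribˡ-+-* w m E) ⟩
        b * (w ^ m * w ^ E)                ≡⟨ regroup b (w ^ m) (w ^ E) ⟩
        v * w ^ m                          ≈⟨ *-congʳ-mod (w ^ m) (mod-sym uᵗ≡v) ⟩
        (w ^ (p ℕ.^ j)) ^ τ * w ^ m        ≡⟨ cong (_* w ^ m) (ℤ.^-*-assoc w (p ℕ.^ j) τ) ⟩
        w ^ (p ℕ.^ j ℕ.* τ) * w ^ m        ≡⟨ ℤ.^-distribˡ-+-* w (p ℕ.^ j ℕ.* τ) m ⟨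
        w ^ (p ℕ.^ j ℕ.* τ ℕ.+ m)          ∎
        where open mod-Reasoning (P * M)

  primitive-root-mod-power : ∀ α → ∃ λ G → ¬ P ∣ℤ G × (∀ a → ¬ P ∣ℤ a → ∃ λ k → a ≡ G ^ k mod P ^ suc α)
  primitive-root-mod-power α = G , P∤G , generates-mod-M
    where
    M = P ^ suc α
    P∣M : P ∣ℤ M
    P∣M = P∣P^[1+j] α
    P∤g : ¬ P ∣ℤ g
    P∤g = order⇒∤ order-g
    h = g ^ (p ℕ.^ α)
    G = h * (1ℤ + P)
    h^[p-1]≡1 : h ^ p-1 ≡ 1ℤ mod M
    h^[p-1]≡1 = subst (_≡ 1ℤ mod M) swap-exponents (≡1-lift-^ (fermat P∤g) α)
      where
      swap-exponents : (g ^ p-1) ^ (p ℕ.^ α) ≡ h ^ p-1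
      swap-exponents = trans (ℤ.^-*-assoc g p-1 (p ℕ.^ α))
        (trans (cong (g ^_) (ℕ.*-comm p-1 (p ℕ.^ α))) (sym (ℤ.^-*-assoc g (p ℕ.^ α) p-1)))
    h≡g : h ≡ g mod P
    h≡g = ^-p^k-mod g α (fermat P∤g)
    P∤G : ¬ P ∣ℤ G
    P∤G = ∤-* (∤-resp-mod (mod-sym h≡g) P∤g) (∤-resp-mod (mod-sym 1+P≡1) ∤1)
    G^[p-1]≡w : G ^ p-1 ≡ w mod M
    G^[p-1]≡w = begin
      G ^ p-1                ≡⟨ ^-distribʳ-* h (1ℤ + P) p-1 ⟩
      h ^ p-1 * w            ≈⟨ *-congʳ-mod w h^[p-1]≡1 ⟩
      1ℤ * w                 ≡⟨ ℤ.*-identityˡ w ⟩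
      w                      ∎
      where open mod-Reasoning M
    G^p^α≡h : G ^ (p ℕ.^ α) ≡ h mod M
    G^p^α≡h = begin
      G ^ (p ℕ.^ α)                              ≡⟨ ^-distribʳ-* h (1ℤ + P) (p ℕ.^ α) ⟩
      h ^ (p ℕ.^ α) * (1ℤ + P) ^ (p ℕ.^ α)       ≈⟨ *-cong-mod (^-p^k-mod h α h^[p-1]≡1) (≡1-lift-^ 1+P≡1 α) ⟩
      h * 1ℤ                                     ≡⟨ ℤ.*-identityʳ h ⟩
      h                                          ∎
      where open mod-Reasoning M
    generates-mod-M : ∀ a → ¬ P ∣ℤ a → ∃ λ k → a ≡ G ^ k mod M
    generates-mod-M a P∤a = from-index (generates a P∤a)
      where
      from-index : (∃ λ i → a ≡ g ^ i mod P) → ∃ λ k → a ≡ G ^ k mod M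
      from-index (i , a≡gⁱ) = from-w-power (≡1⇒power-of-w b≡1 α)
        where
        b = a * h ^ (i ℕ.* p-2)
        hⁱ⁺ⁱ⁽ᵖ⁻²⁾≡1 : h ^ (i ℕ.+ i ℕ.* p-2) ≡ 1ℤ mod M
        hⁱ⁺ⁱ⁽ᵖ⁻²⁾≡1 = ^≡1-mod-∣ h p-1 h^[p-1]≡1 (divides i (begin
          i ℕ.+ i ℕ.* p-2     ≡⟨ ℕ.*-suc i p-2 ⟨
          i ℕ.* suc p-2       ≡⟨ cong (i ℕ.*_) p-1≡1+[p-2] ⟨
          i ℕ.* p-1           ∎))
          where open ≡-Reasoning
        b≡1 : b ≡ 1ℤ mod P
        b≡1 = begin
          a * h ^ (i ℕ.* p-2)         ≈⟨ *-congʳ-mod (h ^ (i ℕ.* p-2)) (mod-trans a≡gⁱ (^-cong-mod i (mod-sym h≡g))) ⟩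
          h ^ i * h ^ (i ℕ.* p-2)     ≡⟨ ℤ.^-distribˡ-+-* h i (i ℕ.* p-2) ⟨
          h ^ (i ℕ.+ i ℕ.* p-2)       ≈⟨ mod-∣ P∣M hⁱ⁺ⁱ⁽ᵖ⁻²⁾≡1 ⟩
          1ℤ                          ∎
          where open mod-Reasoning P
        from-w-power : (∃ λ m → b ≡ w ^ m mod M) → ∃ λ k → a ≡ G ^ k mod M
        from-w-power (m , b≡wᵐ) = p-1 ℕ.* m ℕ.+ p ℕ.^ α ℕ.* i , (begin
          a                                              ≡⟨ ℤ.*-identityʳ a ⟨
          a * 1ℤ                                         ≈⟨ *-congˡ-mod a (mod-sym hⁱ⁺ⁱ⁽ᵖ⁻²⁾≡1) ⟩
          a * h ^ (i ℕ.+ i ℕ.* p-2)                      ≡⟨ cong (a *_) (ℤ.^-distribˡ-+-* h i (i ℕ.* p-2)) ⟩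
          a * (h ^ i * h ^ (i ℕ.* p-2))                  ≡⟨ regroup a (h ^ i) (h ^ (i ℕ.* p-2)) ⟩
          b * h ^ i                                      ≈⟨ *-cong-mod b≡wᵐ (^-cong-mod i (mod-sym G^p^α≡h)) ⟩
          w ^ m * (G ^ (p ℕ.^ α)) ^ i                    ≈⟨ *-congʳ-mod _ (^-cong-mod m (mod-sym G^[p-1]≡w)) ⟩
          (G ^ p-1) ^ m * (G ^ (p ℕ.^ α)) ^ i            ≡⟨ cong₂ _*_ (ℤ.^-*-assoc G p-1 m) (ℤ.^-*-assoc G (p ℕ.^ α) i) ⟩
          G ^ (p-1 ℕ.* m) * G ^ (p ℕ.^ α ℕ.* i)          ≡⟨ ℤ.^-distribˡ-+-* G (p-1 ℕ.* m) (p ℕ.^ α ℕ.* i) ⟨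
          G ^ (p-1 ℕ.* m ℕ.+ p ℕ.^ α ℕ.* i)              ∎)
          where
          open mod-Reasoning M
          regroup : ∀ a x y → a * (x * y) ≡ a * y * x
          regroup = solve-∀

-- Cyclic unit groups

unit-with-residues : ∀ {p} → Prime p → ∀ k R n .{{_ : NonZero n}} → n ≡ p ℕ.^ suc k ℕ.* R → ¬ p ∣ R →
                     ∀ u → ¬ + p ∣ℤ u → ∃ λ a → IsUnit n a × + a ≡ u mod + (p ℕ.^ suc k) × + a ≡ 1ℤ mod + R
unit-with-residues {p} prime-p k R n n≡p^k*R p∤R u p∤u = from-crt (chinese-remainder p^k⊥R u 1ℤ)
  where
  p^k⊥R : Coprime (p ℕ.^ suc k) R
  p^k⊥R = Cop.sym (prime∤⇒coprime-^ prime-p p∤R (suc k))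
  from-crt : (∃ λ x → x ≡ u mod + (p ℕ.^ suc k) × x ≡ 1ℤ mod + R) →
             ∃ λ a → IsUnit n a × + a ≡ u mod + (p ℕ.^ suc k) × + a ≡ 1ℤ mod + R
  from-crt (x , x≡u , x≡1) = x %ℕ n , (ℤ.n%ℕd<d x n , a⊥n) , a≡u , a≡1
    where
    a≡x : + (x %ℕ n) ≡ x mod + n
    a≡x = mod-sym (%ℕ-mod x n)
    a≡u : + (x %ℕ n) ≡ u mod + (p ℕ.^ suc k)
    a≡u = mod-trans (mod-∣ (ℤ.∣ᵤ⇒∣ (divides R (trans n≡p^k*R (ℕ.*-comm _ R)))) a≡x) x≡u
    a≡1 : + (x %ℕ n) ≡ 1ℤ mod + R
    a≡1 = mod-trans (mod-∣ (ℤ.∣ᵤ⇒∣ (divides (p ℕ.^ suc k) n≡p^k*R)) a≡x) x≡1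
    p∤a : ¬ p ∣ x %ℕ n
    p∤a p∣a = p∤u (≡0-mod⇒∣ (mod-trans (mod-sym (mod-∣ (ℤ.∣ᵤ⇒∣ (ℕ.m∣m*n (p ℕ.^ k))) a≡u)) (∣⇒≡0-mod (ℤ.∣ᵤ⇒∣ p∣a))))
    a⊥n : Coprime (x %ℕ n) n
    a⊥n = subst (Coprime (x %ℕ n)) (sym n≡p^k*R) (coprime-* (prime∤⇒coprime-^ prime-p p∤a (suc k)) (≡1-mod⇒coprime a≡1))

cyclic-from-generator : ∀ n .{{_ : NonZero n}} G → Coprime (G %ℕ n) n →
                        (∀ a → IsUnit n a → ∃ λ k → + a ≡ G ^ k mod + n) → Cyclic n
cyclic-from-generator n G g⊥n generates = G %ℕ n , (ℤ.n%ℕd<d G n , g⊥n) , λ a unit-a → as-power (proj₁ unit-a) (generates a unit-a)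
  where
  g = G %ℕ n
  as-power : ∀ {a} → a < n → (∃ λ k → + a ≡ G ^ k mod + n) → ∃ λ k → (g ℕ.^ k) ℕ.% n ≡ a
  as-power {a} a<n (k , a≡Gᵏ) = k , trans (mod⇒%ℕ-≡ n (+ (g ℕ.^ k)) (+ a) gᵏ≡a) (ℕ.m<n⇒m%n≡m a<n)
    where
    open mod-Reasoning (+ n)
    gᵏ≡a : + (g ℕ.^ k) ≡ + a mod + n
    gᵏ≡a = begin
      + (g ℕ.^ k)    ≡⟨ pos-^ g k ⟩
      (+ g) ^ k      ≈⟨ ^-cong-mod k (mod-sym (%ℕ-mod G n)) ⟩
      G ^ k          ≈⟨ mod-sym a≡Gᵏ ⟩
      + a            ∎

unit⇒∤ : ∀ {p n a} → Prime p → p ∣ n → IsUnit n a → ¬ + p ∣ℤ + a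
unit⇒∤ prime-p p∣n (_ , a⊥n) p∣a = coprime⇒∤ prime-p a⊥n p∣n (ℤ.∣⇒∣ᵤ p∣a)

residue-coprime-^ : ∀ {p} → Prime p → ∀ n .{{_ : NonZero n}} e {x} → p ∣ n → ¬ + p ∣ℤ x → Coprime (x %ℕ n) (p ℕ.^ e)
residue-coprime-^ prime-p n e {x} p∣n p∤x = prime∤⇒coprime-^ prime-p p∤residue e
  where
  p∤residue : ¬ _ ∣ x %ℕ n
  p∤residue p∣r = p∤x (≡0-mod⇒∣ (mod-trans (mod-∣ (ℤ.∣ᵤ⇒∣ p∣n) (%ℕ-mod x n)) (∣⇒≡0-mod (ℤ.∣ᵤ⇒∣ p∣r))))

module _ {p : ℕ} (prime-p : Prime p) (2∤p : ¬ 2 ∣ p) where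

  open OddPrimePower prime-p 2∤p using (primitive-root-mod-power)

  private instance
    p≢0 : NonZero p
    p≢0 = prime⇒nonZero prime-p

  ^-as-ℤ : ∀ k → (+ p) ^ k ≡ + (p ℕ.^ k)
  ^-as-ℤ k = sym (pos-^ p k)

  cyclic-p^ : ∀ α n .{{_ : NonZero n}} → n ≡ p ℕ.^ suc α → Cyclic n
  cyclic-p^ α n refl = from-generator (primitive-root-mod-power α)
    where
    from-generator : (∃ λ G → ¬ + p ∣ℤ G × (∀ a → ¬ + p ∣ℤ a → ∃ λ k → a ≡ G ^ k mod (+ p) ^ suc α)) → Cyclic n
    from-generator (G , p∤G , generates) = cyclic-from-generator n G
      (residue-coprime-^ prime-p n (suc α) (ℕ.m∣m*n (p ℕ.^ α)) p∤G)
      λ a unit-a → subst (λ d → ∃ λ k → + a ≡ G ^ k mod d) (^-as-ℤ (suc α))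
                     (generates (+ a) (unit⇒∤ prime-p (ℕ.m∣m*n (p ℕ.^ α)) unit-a))

  cyclic-2p^ : ∀ α n .{{_ : NonZero n}} → n ≡ 2 ℕ.* p ℕ.^ suc α → Cyclic n
  cyclic-2p^ α n refl = from-generator (primitive-root-mod-power α)
    where
    N = p ℕ.^ suc α
    p∣N : p ∣ N
    p∣N = ℕ.m∣m*n (p ℕ.^ α)
    2∤N : ¬ 2 ∣ N
    2∤N 2∣N = 2∤p (prime∣^⇒∣ prime[2] (suc α) 2∣N)
    2⊥N : Coprime 2 N
    2⊥N = prime∤⇒coprime-^ prime-p p∤2 (suc α)
      where
      p∤2 : ¬ p ∣ 2
      p∤2 p∣2 with prime⇒irreducible prime[2] p∣2
      ... | inj₁ p≡1 = ℕ.<⇒≢ (prime>1 prime-p) (sym p≡1)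
      ... | inj₂ refl = 2∤p ℕ.∣-refl
    odd-representative : ∀ G → Dec (+ 2 ∣ℤ G) → ∃ λ G′ → ¬ + 2 ∣ℤ G′ × G′ ≡ G mod + N
    odd-representative G (no 2∤G)  = G , 2∤G , mod-refl
    odd-representative G (yes 2∣G) = G + + N , (λ 2∣G+N → 2∤N (ℤ.∣⇒∣ᵤ (ℤ.∣m+n∣m⇒∣n 2∣G+N 2∣G))) ,
      mod-by (subst (+ N ∣ℤ_) (cancel G (+ N)) (ℤ.∣-refl {+ N}))
      where
      cancel : ∀ G N → N ≡ G + N - G
      cancel = solve-∀
    from-generator : (∃ λ G → ¬ + p ∣ℤ G × (∀ a → ¬ + p ∣ℤ a → ∃ λ k → a ≡ G ^ k mod (+ p) ^ suc α)) → Cyclic n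
    from-generator (G , p∤G , generates) = cyclic-from-generator n G′
      (coprime-* (residue-coprime-^ prime[2] n 1 (ℕ.m∣m*n N) 2∤G′)
                 (residue-coprime-^ prime-p n (suc α) (ℕ.∣n⇒∣m*n 2 p∣N) (∤-resp-mod (mod-∣ (ℤ.∣ᵤ⇒∣ p∣N) (mod-sym G′≡G)) p∤G)))
      λ a unit-a → as-power a unit-a (generates (+ a) (unit⇒∤ prime-p (ℕ.∣n⇒∣m*n 2 p∣N) unit-a))
      where
      open ModPrime prime-p using (∤-resp-mod)
      open ModPrime prime[2] using () renaming (∤-^ to 2∤-^)
      G′ = proj₁ (odd-representative G (+ 2 ℤ.∣? G))
      2∤G′ = proj₁ (proj₂ (odd-representative G (+ 2 ℤ.∣? G)))
      G′≡G = proj₂ (proj₂ (odd-representative G (+ 2 ℤ.∣? G)))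
      as-power : ∀ a → IsUnit n a → (∃ λ k → + a ≡ G ^ k mod (+ p) ^ suc α) → ∃ λ k → + a ≡ G′ ^ k mod + n
      as-power a unit-a (k , a≡Gᵏ) = k , combine-mod 2⊥N
        (mod-trans (odd⇒≡1-mod-2 (unit⇒∤ prime[2] (ℕ.m∣m*n N) unit-a)) (mod-sym (odd⇒≡1-mod-2 (2∤-^ 2∤G′ k))))
        (mod-trans (subst (λ d → + a ≡ G ^ k mod d) (^-as-ℤ (suc α)) a≡Gᵏ) (^-cong-mod k (mod-sym G′≡G)))

cyclic-1 : Cyclic 1
cyclic-1 = 0 , (s≤s z≤n , λ (_ , i∣1) → ℕ.∣1⇒≡1 i∣1) , powers
  where
  powers : ∀ a → IsUnit 1 a → ∃ λ k → (0 ℕ.^ k) ℕ.% 1 ≡ a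
  powers zero    _              = 0 , refl
  powers (suc a) (s≤s () , _)

cyclic-2 : Cyclic 2
cyclic-2 = 1 , (s≤s (s≤s z≤n) , Cop.1-coprimeTo 2) , powers
  where
  powers : ∀ a → IsUnit 2 a → ∃ λ k → (1 ℕ.^ k) ℕ.% 2 ≡ a
  powers 0             (_ , 0⊥2) = ⊥-elim (Cop.¬0-coprimeTo-2+ 0⊥2)
  powers 1             _         = 0 , refl
  powers (suc (suc a)) (s≤s (s≤s ()) , _)

cyclic-4 : Cyclic 4
cyclic-4 = 3 , (s≤s (s≤s (s≤s (s≤s z≤n))) , toWitness {a? = Cop.coprime? 3 4} _) , powers
  where
  powers : ∀ a → IsUnit 4 a → ∃ λ k → (3 ℕ.^ k) ℕ.% 4 ≡ a
  powers 0 (_ , 0⊥4) = ⊥-elim (Cop.¬0-coprimeTo-2+ 0⊥4)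
  powers 1 _         = 0 , refl
  powers 2 (_ , 2⊥4) = case 2⊥4 (ℕ.∣-refl , divides 2 refl) of λ ()
  powers 3 _         = 1 , refl
  powers (suc (suc (suc (suc a)))) (s≤s (s≤s (s≤s (s≤s ()))) , _)

-- Quadratic non-residues and χ₃

infix 4 _IsNonSquareMod_
_IsNonSquareMod_ : ℤ → ℤ → Set
a IsNonSquareMod d = ∀ x → ¬ x * x ≡ a mod d

non-square-resp-mod : ∀ {a b d} → a ≡ b mod d → a IsNonSquareMod d → b IsNonSquareMod d
non-square-resp-mod a≡b a-non-square x x²≡b = a-non-square x (mod-trans x²≡b (mod-sym a≡b))

non-square-*-≡1 : ∀ {a b d} → a IsNonSquareMod d → b ≡ 1ℤ mod d → a * b IsNonSquareMod d
non-square-*-≡1 {a} a-non-square b≡1 =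
  non-square-resp-mod (mod-trans (mod-reflexive (sym (ℤ.*-identityʳ a))) (*-congˡ-mod a (mod-sym b≡1))) a-non-square

non-square-from-residues : ∀ d .{{_ : NonZero d}} a → (∀ (r : Fin d) → (toℕ r ℕ.* toℕ r) ℕ.% d ≢ a ℕ.% d) →
                           + a IsNonSquareMod + d
non-square-from-residues d a no-root x x²≡a =
  no-root r (mod⇒%ℕ-≡ d (+ (toℕ r ℕ.* toℕ r)) (+ a) (begin
    + (toℕ r ℕ.* toℕ r)      ≡⟨ ℤ.pos-* (toℕ r) (toℕ r) ⟩
    + toℕ r * + toℕ r        ≈⟨ *-cong-mod (mod-sym x≡r) (mod-sym x≡r) ⟩
    x * x                    ≈⟨ x²≡a ⟩
    + a                      ∎))
  where
  open mod-Reasoning (+ d)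
  r : Fin d
  r = fromℕ< (ℤ.n%ℕd<d x d)
  x≡r : x ≡ + toℕ r mod + d
  x≡r = subst (λ k → x ≡ + k mod + d) (sym (FinP.toℕ-fromℕ< (ℤ.n%ℕd<d x d))) (%ℕ-mod x d)

-- The with-abstraction repeats the one in the definition of χ₃, so that χ₃ n a computes.
χ₃-non-square : ∀ n .{{_ : NonZero n}} {d} a → d ∣ n → + a IsNonSquareMod + d → χ₃ n a ≡ - 1ℤ
χ₃-non-square n {d} a d∣n a-non-square with FinP.any? {n} (λ (x : Fin n) → ((toℕ x ℕ.* toℕ x) ℕ.% n) ℕ.≟ (a ℕ.% n))
... | yes (x , x²≡a) = ⊥-elim (a-non-square (+ toℕ x) (mod-∣ (ℤ.∣ᵤ⇒∣ d∣n)
        (subst (_≡ + a mod + n) (ℤ.pos-* (toℕ x) (toℕ x)) (%ℕ-≡⇒mod n (+ (toℕ x ℕ.* toℕ x)) (+ a) x²≡a))))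
... | no _ = refl

non-squares⇒¬multiplicative : ∀ n .{{_ : NonZero n}} {a b d₁ d₂ d₃} → IsUnit n a → IsUnit n b →
  d₁ ∣ n → d₂ ∣ n → d₃ ∣ n → + a IsNonSquareMod + d₁ → + b IsNonSquareMod + d₂ → + a * + b IsNonSquareMod + d₃ →
  ¬ IsMultiplicativeχ₃ n
non-squares⇒¬multiplicative n {a} {b} {d₃ = d₃} unit-a unit-b d₁∣n d₂∣n d₃∣n a-non-square b-non-square ab-non-square χ₃-multiplicative =
  case (begin
    - 1ℤ                          ≡⟨ χ₃-non-square n ((a ℕ.* b) ℕ.% n) d₃∣n ab%n-non-square ⟨
    χ₃ n ((a ℕ.* b) ℕ.% n)        ≡⟨ χ₃-multiplicative a b unit-a unit-b ⟩
    χ₃ n a * χ₃ n b               ≡⟨ cong₂ _*_ (χ₃-non-square n a d₁∣n a-non-square) (χ₃-non-square n b d₂∣n b-non-square) ⟩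
    - 1ℤ * - 1ℤ                   ≡⟨⟩
    1ℤ                            ∎) of λ ()
  where
  open ≡-Reasoning
  ab%n-non-square : + ((a ℕ.* b) ℕ.% n) IsNonSquareMod + d₃
  ab%n-non-square = non-square-resp-mod
    (mod-∣ (ℤ.∣ᵤ⇒∣ d₃∣n) (subst (_≡ + ((a ℕ.* b) ℕ.% n) mod + n) (ℤ.pos-* a b) (%ℕ-mod (+ (a ℕ.* b)) n))) ab-non-square

two-non-squares⇒¬multiplicative : ∀ n .{{_ : NonZero n}} {a b d₁ d₂} → IsUnit n a → IsUnit n b →
  d₁ ∣ n → d₂ ∣ n → + a IsNonSquareMod + d₁ → + b IsNonSquareMod + d₂ → + b ≡ 1ℤ mod + d₁ → ¬ IsMultiplicativeχ₃ n
two-non-squares⇒¬multiplicative n unit-a unit-b d₁∣n d₂∣n a-non-square b-non-square b≡1 =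
  non-squares⇒¬multiplicative n unit-a unit-b d₁∣n d₂∣n d₁∣n a-non-square b-non-square (non-square-*-≡1 a-non-square b≡1)

3-non-square-mod-4 : + 3 IsNonSquareMod + 4
3-non-square-mod-4 = non-square-from-residues 4 3
  (toWitness {a? = FinP.all? λ r → ¬? ((toℕ r ℕ.* toℕ r) ℕ.% 4 ℕ.≟ 3)} _)

non-square-unit : ∀ {p n} .{{_ : NonZero n}} → Prime p → ¬ 2 ∣ p → p ∣ n →
                  ∃ λ a → IsUnit n a × + a IsNonSquareMod + p × (∀ d → d ∣ n → ¬ p ∣ d → + a ≡ 1ℤ mod + d)
non-square-unit {p} {n} prime-p 2∤p p∣n = split (prime-power-split prime-p n)
  where
  open ModPrime prime-p using (primitive-root; primitive-root-non-square; order⇒∤; module PrimitiveRoot)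
  open PrimitiveRoot primitive-root renaming (root to g; order to order-g)
  split : (∃₂ λ f R → n ≡ p ℕ.^ f ℕ.* R × ¬ p ∣ R) →
          ∃ λ a → IsUnit n a × + a IsNonSquareMod + p × (∀ d → d ∣ n → ¬ p ∣ d → + a ≡ 1ℤ mod + d)
  split (zero , R , n≡R , p∤R) = ⊥-elim (p∤R (subst (p ∣_) (trans n≡R (ℕ.+-identityʳ R)) p∣n))
  split (suc k , R , n≡p^f*R , p∤R) = with-unit (unit-with-residues prime-p k R n n≡p^f*R p∤R g (order⇒∤ order-g))
    where
    with-unit : (∃ λ a → IsUnit n a × + a ≡ g mod + (p ℕ.^ suc k) × + a ≡ 1ℤ mod + R) →
                ∃ λ a → IsUnit n a × + a IsNonSquareMod + p × (∀ d → d ∣ n → ¬ p ∣ d → + a ≡ 1ℤ mod + d)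
    with-unit (a , unit-a , a≡g , a≡1) =
      a , unit-a ,
      non-square-resp-mod (mod-sym (mod-∣ (ℤ.∣ᵤ⇒∣ (ℕ.m∣m*n (p ℕ.^ k))) a≡g)) (primitive-root-non-square 2∤p primitive-root) ,
      λ d d∣n p∤d → mod-∣ (ℤ.∣ᵤ⇒∣ (coprime-divisor (prime∤⇒coprime-^ prime-p p∤d (suc k)) (subst (d ∣_) n≡p^f*R d∣n))) a≡1

2^2+e-non-square-unit : ∀ e m n .{{_ : NonZero n}} → n ≡ 2 ℕ.^ suc (suc e) ℕ.* m → ¬ 2 ∣ m →
                        ∃ λ b → IsUnit n b × + b IsNonSquareMod + 4 × + b ≡ 1ℤ mod + m
2^2+e-non-square-unit e m n n≡2^e*m 2∤m = with-unit (unit-with-residues prime[2] (suc e) m n n≡2^e*m 2∤m (+ 3) 2∤3)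
  where
  quadruple : ∀ x → 2 ℕ.* (2 ℕ.* x) ≡ x ℕ.* 4
  quadruple = ℕ.solve-∀
  2∤3 : ¬ + 2 ∣ℤ + 3
  2∤3 2∣3 = toWitnessFalse {a? = 2 ℕ.∣? 3} _ (ℤ.∣⇒∣ᵤ 2∣3)
  with-unit : (∃ λ b → IsUnit n b × + b ≡ + 3 mod + (2 ℕ.^ suc (suc e)) × + b ≡ 1ℤ mod + m) →
              ∃ λ b → IsUnit n b × + b IsNonSquareMod + 4 × + b ≡ 1ℤ mod + m
  with-unit (b , unit-b , b≡3 , b≡1) =
    b , unit-b , non-square-resp-mod (mod-sym (mod-∣ (ℤ.∣ᵤ⇒∣ (divides (2 ℕ.^ e) (quadruple (2 ℕ.^ e)))) b≡3)) 3-non-square-mod-4 , b≡1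

-- Classification

power-of-two-case : ∀ e n .{{_ : NonZero n}} → n ≡ 2 ℕ.^ e → Cyclic n ⊎ ¬ IsMultiplicativeχ₃ n
power-of-two-case 0 .1 refl = inj₁ cyclic-1
power-of-two-case 1 .2 refl = inj₁ cyclic-2
power-of-two-case 2 .4 refl = inj₁ cyclic-4
power-of-two-case (suc (suc (suc e))) n n≡2^[3+e] =
  inj₂ (non-squares⇒¬multiplicative n (odd-unit 3 (s≤s (s≤s (s≤s (s≤s z≤n))))) (odd-unit 5 (s≤s (s≤s (s≤s (s≤s (s≤s (s≤s z≤n)))))))
          8∣n 8∣n 8∣n (mod-8 3) (mod-8 5) (mod-8 15))
  where
  octuple : ∀ x → 2 ℕ.* (2 ℕ.* (2 ℕ.* x)) ≡ x ℕ.* 8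
  octuple = ℕ.solve-∀
  8∣n : 8 ∣ n
  8∣n = divides (2 ℕ.^ e) (trans n≡2^[3+e] (octuple (2 ℕ.^ e)))
  odd-unit : ∀ a → a < 8 → {True (Dec.¬? (2 ℕ.∣? a))} → IsUnit n a
  odd-unit a a<8 {2∤a} = ℕ.<-≤-trans a<8 (ℕ.∣⇒≤ 8∣n) ,
    subst (Coprime a) (sym n≡2^[3+e]) (prime∤⇒coprime-^ prime[2] (toWitness 2∤a) (3 ℕ.+ e))
  mod-8 : ∀ a → {True (FinP.all? λ (r : Fin 8) → ¬? ((toℕ r ℕ.* toℕ r) ℕ.% 8 ℕ.≟ a ℕ.% 8))} → + a IsNonSquareMod + 8
  mod-8 a {no-root} = non-square-from-residues 8 a (toWitness no-root)

odd-prime-power-case : ∀ {p} → Prime p → ¬ 2 ∣ p → ∀ e α n .{{_ : NonZero n}} → n ≡ 2 ℕ.^ e ℕ.* p ℕ.^ suc α →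
                       Cyclic n ⊎ ¬ IsMultiplicativeχ₃ n
odd-prime-power-case prime-p 2∤p 0             α n n≡p^[1+α]  = inj₁ (cyclic-p^ prime-p 2∤p α n (trans n≡p^[1+α] (ℕ.+-identityʳ _)))
odd-prime-power-case prime-p 2∤p 1             α n n≡2p^[1+α] = inj₁ (cyclic-2p^ prime-p 2∤p α n n≡2p^[1+α])
odd-prime-power-case {p} prime-p 2∤p (suc (suc e)) α n n≡2^e*p^[1+α] =
  inj₂ (combine (non-square-unit prime-p 2∤p p∣n) (2^2+e-non-square-unit e (p ℕ.^ suc α) n n≡2^e*p^[1+α] 2∤p^[1+α]))
  where
  2∤p^[1+α] : ¬ 2 ∣ p ℕ.^ suc α
  2∤p^[1+α] 2∣p^[1+α] = 2∤p (prime∣^⇒∣ prime[2] (suc α) 2∣p^[1+α])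
  p∣n : p ∣ n
  p∣n = ℕ.∣-trans (ℕ.m∣m*n (p ℕ.^ α)) (divides (2 ℕ.^ suc (suc e)) n≡2^e*p^[1+α])
  4∣n : 4 ∣ n
  4∣n = ℕ.∣-trans (divides (2 ℕ.^ e) (quadruple (2 ℕ.^ e))) (divides (p ℕ.^ suc α) (trans n≡2^e*p^[1+α] (ℕ.*-comm (2 ℕ.^ suc (suc e)) (p ℕ.^ suc α))))
    where
    quadruple : ∀ x → 2 ℕ.* (2 ℕ.* x) ≡ x ℕ.* 4
    quadruple = ℕ.solve-∀
  combine : (∃ λ a → IsUnit n a × + a IsNonSquareMod + p × (∀ d → d ∣ n → ¬ p ∣ d → + a ≡ 1ℤ mod + d)) →
            (∃ λ b → IsUnit n b × + b IsNonSquareMod + 4 × + b ≡ 1ℤ mod + (p ℕ.^ suc α)) → ¬ IsMultiplicativeχ₃ n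
  combine (a , unit-a , a-non-square , _) (b , unit-b , b-non-square , b≡1) =
    two-non-squares⇒¬multiplicative n unit-a unit-b p∣n 4∣n a-non-square b-non-square
      (mod-∣ (ℤ.∣ᵤ⇒∣ (ℕ.m∣m*n (p ℕ.^ α))) b≡1)

two-odd-primes-case : ∀ {p q n} .{{_ : NonZero n}} → Prime p → Prime q → ¬ 2 ∣ p → ¬ 2 ∣ q → ¬ q ∣ p →
                      p ∣ n → q ∣ n → ¬ IsMultiplicativeχ₃ n
two-odd-primes-case {p} {q} {n} prime-p prime-q 2∤p 2∤q q∤p p∣n q∣n =
  combine (non-square-unit prime-p 2∤p p∣n) (non-square-unit prime-q 2∤q q∣n)
  where
  NonSquareUnit : ℕ → Set
  NonSquareUnit r = ∃ λ a → IsUnit n a × + a IsNonSquareMod + r × (∀ d → d ∣ n → ¬ r ∣ d → + a ≡ 1ℤ mod + d)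
  combine : NonSquareUnit p → NonSquareUnit q → ¬ IsMultiplicativeχ₃ n
  combine (a , unit-a , a-non-square , _) (b , unit-b , b-non-square , b≡1) =
    two-non-squares⇒¬multiplicative n unit-a unit-b p∣n q∣n a-non-square b-non-square (b≡1 p p∣n q∤p)

classify : ∀ n .{{_ : NonZero n}} → Cyclic n ⊎ ¬ IsMultiplicativeχ₃ n
classify n = split-two (prime-power-split prime[2] n)
  where
  split-two : (∃₂ λ e m → n ≡ 2 ℕ.^ e ℕ.* m × ¬ 2 ∣ m) → Cyclic n ⊎ ¬ IsMultiplicativeχ₃ n
  split-two (e , 0 , _ , 2∤0) = ⊥-elim (2∤0 (2 ℕ.∣0))
  split-two (e , 1 , n≡2^e*1 , _) = power-of-two-case e n (trans n≡2^e*1 (ℕ.*-identityʳ _))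
  split-two (e , m@(suc (suc _)) , n≡2^e*m , 2∤m) = split-odd (prime-divisor m)
    where
    m∣n : m ∣ n
    m∣n = divides (2 ℕ.^ e) n≡2^e*m
    split-odd : (∃ λ p → Prime p × p ∣ m) → Cyclic n ⊎ ¬ IsMultiplicativeχ₃ n
    split-odd (p , prime-p , p∣m) = split-p (prime-power-split prime-p m)
      where
      2∤p : ¬ 2 ∣ p
      2∤p 2∣p = 2∤m (ℕ.∣-trans 2∣p p∣m)
      split-p : (∃₂ λ α r → m ≡ p ℕ.^ α ℕ.* r × ¬ p ∣ r) → Cyclic n ⊎ ¬ IsMultiplicativeχ₃ n
      split-p (0 , r , m≡r , p∤r) = ⊥-elim (p∤r (subst (p ∣_) (trans m≡r (ℕ.+-identityʳ r)) p∣m))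
      split-p (suc α , 0 , _ , p∤0) = ⊥-elim (p∤0 (p ℕ.∣0))
      split-p (suc α , 1 , m≡p^[1+α] , _) =
        odd-prime-power-case prime-p 2∤p e α n (trans n≡2^e*m (cong (2 ℕ.^ e ℕ.*_) (trans m≡p^[1+α] (ℕ.*-identityʳ _))))
      split-p (suc α , r@(suc (suc _)) , m≡p^[1+α]*r , p∤r) = inj₂ (another-prime (prime-divisor r))
        where
        another-prime : (∃ λ q → Prime q × q ∣ r) → ¬ IsMultiplicativeχ₃ n
        another-prime (q , prime-q , q∣r) =
          two-odd-primes-case prime-p prime-q 2∤p (λ 2∣q → 2∤m (ℕ.∣-trans 2∣q q∣m)) q∤p (ℕ.∣-trans p∣m m∣n) (ℕ.∣-trans q∣m m∣n)
          where
          q∣m : q ∣ m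
          q∣m = ℕ.∣-trans q∣r (divides (p ℕ.^ suc α) m≡p^[1+α]*r)
          q∤p : ¬ q ∣ p
          q∤p q∣p with prime⇒irreducible prime-p q∣p
          ... | inj₁ q≡1  = ℕ.<⇒≢ (prime>1 prime-q) (sym q≡1)
          ... | inj₂ refl = p∤r q∣r

corollary2p5 : (n : ℕ) → .{{_ : NonZero n}} → ¬ Cyclic n → ¬ IsMultiplicativeχ₃ n
corollary2p5 n ¬cyclic = [ ⊥-elim ∘ ¬cyclic , id ]′ (classify n)
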